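{- The emptiness problem for register set automata with register equality test is undecidable.
   Context: Fix a finite nonempty alphabet $\Sigma$ and an infinite data domain $\mathbb{D}$. A register set automaton with register equality test is a tuple $(Q,R,\Delta,I,F)$ with $Q$ finite states, $R$ finite registers, $I,F\subseteq Q$, and transitions $q\xrightarrow{a\mid G^{\in},G^{\notin},G^{=},up}s$ with $a\in\Sigma$, $G^{\in},G^{\notin}\subseteq R$, $G^{=}\colon R\to 2^{R}$, and $up\colon R\to 2^{R\cup\{\mathit{in}\}}$. Configurations are $(q,f)$ with $f\colon R\to 2^{\mathbb{D}}$; initial ones have $q\in I$ and all registers empty. A step over $(a,d)\in\Sigma\times\mathbb{D}$ is possible iff $d\in f(r)$ for all $r\in G^{\in}$, $d\notin f(r)$ for all $r\in G^{\notin}$, and $f(r')=f(r)$ for all $r\in R$ and $r'\in G^{=}(r)$; afterwards each register $r$ holds $\bigcup\{f(r')\mid r'\in R\cap up(r)\}$, plus $d$ if $\mathit{in}\in up(r)$. The language is the set of words in $(\Sigma\times\mathbb{D})^*$ with a run from an initial configuration ending in $F$; the emptiness problem asks whether this language is empty. -}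

module Defs where

open import Data.Nat using (ℕ; zero; suc; _+_; _<_)
open import Data.Fin using (Fin; toℕ)
open import Data.Fin.Subset using (Subset; _∈_)
open import Data.Vec using (Vec; []; _∷_; lookup)
open import Data.List using (List; []; _∷_)
open import Data.List.Relation.Unary.Any using (Any)
open import Data.Bool using (Bool; true; false)
open import Data.Product using (Σ; ∃; _×_; _,_)
open import Data.Sum using (_⊎_)
open import Relation.Binary.PropositionalEquality using (_≡_)
open import Relation.Nullary using (¬_)

-- Register set automata with register equality test
--   Σ = Fin (suc k)   (finite nonempty alphabet)
--   Q = Fin n, R = Fin m
--   subsets of a finite set are Data.Fin.Subset (Vec Bool _)

record Transition (k n m : ℕ) : Set where
  constructor mkTransition
  field
    source  : Fin n
    letter  : Fin (suc k)
    Gin     : Subset m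
    Gnotin  : Subset m
    Geq     : Vec (Subset m) m
    upReg   : Vec (Subset m) m       -- up(r) ∩ R
    upIn    : Subset m               -- r ∈ upIn  iff  in ∈ up(r)
    target  : Fin n

record RSA (k : ℕ) : Set where
  constructor mkRSA
  field
    nStates : ℕ
    nRegs   : ℕ
    Δ       : List (Transition k nStates nRegs)
    I       : Subset nStates
    F       : Subset nStates

Regs : Set → ℕ → Set₁
Regs 𝔻 m = Fin m → 𝔻 → Set

emptyRegs : ∀ {𝔻 m} → Regs 𝔻 m
emptyRegs _ _ = ⊥' where open import Data.Empty renaming (⊥ to ⊥')

module _ {𝔻 : Set} {k n m : ℕ} where

  Enabled : Transition k n m → 𝔻 → Regs 𝔻 m → Set
  Enabled t d f =
      (∀ r → r ∈ Transition.Gin t → f r d)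
    × (∀ r → r ∈ Transition.Gnotin t → ¬ f r d)
    × (∀ r r′ → r′ ∈ lookup (Transition.Geq t) r →
         ∀ e → (f r′ e → f r e) × (f r e → f r′ e))

  update : Transition k n m → 𝔻 → Regs 𝔻 m → Regs 𝔻 m
  update t d f r e =
      (Σ (Fin m) λ r′ → r′ ∈ lookup (Transition.upReg t) r × f r′ e)
    ⊎ (r ∈ Transition.upIn t × e ≡ d)

  RunFrom : List (Transition k n m) → Subset n →
            List (Fin (suc k) × 𝔻) → Fin n → Regs 𝔻 m → Set
  RunFrom Δ F [] q f = q ∈ F
  RunFrom Δ F ((a , d) ∷ w) q f =
    Any (λ t → Transition.source t ≡ q × Transition.letter t ≡ a ×
               Enabled t d f ×
               RunFrom Δ F w (Transition.target t) (update t d f)) Δ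

Accepts : (𝔻 : Set) {k : ℕ} → RSA k → List (Fin (suc k) × 𝔻) → Set
Accepts 𝔻 A w =
  Σ (Fin nStates) λ q → q ∈ I × RunFrom {𝔻} Δ F w q emptyRegs
  where open RSA A

IsEmpty : (𝔻 : Set) {k : ℕ} → RSA k → Set
IsEmpty 𝔻 A = ¬ (Σ (List (Fin _ × 𝔻)) λ w → Accepts 𝔻 A w)

data PR : ℕ → Set where
  zer  : ∀ {n} → PR n
  succ : PR 1
  proj : ∀ {n} → Fin n → PR n
  comp : ∀ {m n} → PR m → Vec (PR n) m → PR n
  prec : ∀ {n} → PR n → PR (suc (suc n)) → PR (suc n)
  mu   : ∀ {n} → PR (suc n) → PR n

mutual
  data Eval : ∀ {n} → PR n → Vec ℕ n → ℕ → Set where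
    e-zer  : ∀ {n} {xs : Vec ℕ n} → Eval zer xs 0
    e-succ : ∀ {x} → Eval succ (x ∷ []) (suc x)
    e-proj : ∀ {n} {i : Fin n} {xs} → Eval (proj i) xs (lookup xs i)
    e-comp : ∀ {m n} {g : PR m} {hs : Vec (PR n) m} {xs ys y} →
             EvalVec hs xs ys → Eval g ys y → Eval (comp g hs) xs y
    e-prec0 : ∀ {n} {g : PR n} {h} {xs y} →
              Eval g xs y → Eval (prec g h) (0 ∷ xs) y
    e-precS : ∀ {n} {g : PR n} {h} {x xs z y} →
              Eval (prec g h) (x ∷ xs) z → Eval h (x ∷ z ∷ xs) y →
              Eval (prec g h) (suc x ∷ xs) y
    e-mu   : ∀ {n} {f : PR (suc n)} {xs y} →
             Eval f (y ∷ xs) 0 →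
             (∀ i → i < y → Σ ℕ λ z → Eval f (i ∷ xs) (suc z)) →
             Eval (mu f) xs y

  data EvalVec : ∀ {m n} → Vec (PR n) m → Vec ℕ n → Vec ℕ m → Set where
    ev-[] : ∀ {n} {xs : Vec ℕ n} → EvalVec [] xs []
    ev-∷  : ∀ {m n} {h : PR n} {hs : Vec (PR n) m} {xs y ys} →
            Eval h xs y → EvalVec hs xs ys → EvalVec (h ∷ hs) xs (y ∷ ys)

-- Gödel numbering of automata (Cantor pairing of lists)

tri : ℕ → ℕ
tri zero    = zero
tri (suc x) = suc x + tri x

pair : ℕ → ℕ → ℕ
pair a b = tri (a + b) + b

encList : List ℕ → ℕ
encList []       = 0
encList (x ∷ xs) = suc (pair x (encList xs))

bitsOf : ∀ {m} → Vec Bool m → List ℕ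
bitsOf []          = []
bitsOf (true ∷ v)  = 1 ∷ bitsOf v
bitsOf (false ∷ v) = 0 ∷ bitsOf v

encSubset : ∀ {m} → Subset m → ℕ
encSubset v = encList (bitsOf v)

encSubsets : ∀ {m l} → Vec (Subset m) l → List ℕ
encSubsets []       = []
encSubsets (s ∷ ss) = encSubset s ∷ encSubsets ss

encTransition : ∀ {k n m} → Transition k n m → ℕ
encTransition (mkTransition s a gi gn ge ur ui t) =
  encList (toℕ s ∷ toℕ a ∷ encSubset gi ∷ encSubset gn ∷
           encList (encSubsets ge) ∷ encList (encSubsets ur) ∷
           encSubset ui ∷ toℕ t ∷ [])

encTransitions : ∀ {k n m} → List (Transition k n m) → List ℕ
encTransitions []       = []
encTransitions (t ∷ ts) = encTransition t ∷ encTransitions ts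

code : ∀ {k} → RSA k → ℕ
code (mkRSA n m Δ I F) =
  encList (n ∷ m ∷ encList (encTransitions Δ) ∷ encSubset I ∷ encSubset F ∷ [])

-- Suppose a μ-recursive p decided emptiness. Build a counter machine that, started with zero
-- counters, first loads four numbers a, b0, c, d into its counters, then computes from them
-- its own code as an automaton, runs p on that code and accepts iff p answers 1 (empty). A
-- counter machine is simulated by a register set automaton with equality test: a counter is
-- the size of X ∖ Y for registers X ⊇ Y, and it is zero iff X = Y. So the automaton of this
-- machine is nonempty iff p declares it empty. The self-reference is possible because the
-- instructions other than the loader do not mention a, b0, c, d, and enter the code only
-- through the number c of their transitions, while the loader is determined by a, b0, c, d.
module Submission where

open import Defs
open import Data.Bool using (true; false; if_then_else_; T)
open import Data.Empty using (⊥; ⊥-elim)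
open import Data.Fin using (Fin; toℕ; _↑ˡ_; _↑ʳ_; #_) renaming (zero to fz; suc to fs)
open import Data.Fin.Properties using (toℕ-↑ˡ; toℕ-↑ʳ; toℕ<n; toℕ-injective) renaming (_≟_ to _≟ᶠ_)
open import Data.Fin.Subset using (Subset; ⁅_⁆; _∈_; _∉_) renaming (⊥ to ∅)
open import Data.Fin.Subset.Properties using (x∈⁅x⁆; x∈⁅y⁆⇒x≡y; ∉⊥)
open import Data.List using (List; []; _∷_; _++_; length; downFrom)
open import Data.List.Properties using (length-++)
open import Data.List.Relation.Unary.All as LAll using () renaming (All to LAll; [] to a[]; _∷_ to _a∷_)
open import Data.List.Relation.Unary.All.Properties using (++⁺; applyDownFrom⁺₁)
open import Data.List.Relation.Unary.Any using (Any; here; there)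
open import Data.List.Relation.Unary.Any.Properties using (++⁻; ++⁺ˡ; ++⁺ʳ)
import Data.List.Membership.Propositional as LM
open import Data.List.Membership.Propositional.Properties using (∈-downFrom⁺; ∈-downFrom⁻)
open import Data.Maybe using (Maybe; just; nothing)
open import Data.Maybe.Properties using (just-injective)
open import Data.Nat
open import Data.Nat.Properties
open import Data.Nat.Solver using (module +-*-Solver)
open import Data.Product using (Σ; _×_; _,_; proj₁; proj₂)
open import Data.Sum using (_⊎_; inj₁; inj₂)
import Data.Sum
open import Data.Unit using (⊤; tt)
open import Data.Vec using (Vec; []; _∷_; lookup; tabulate; replicate; _[_]≔_) renaming (map to vmap)
open import Data.Vec.Properties using (∷-injective; lookup-map; lookup-replicate; lookup∘tabulate; lookup∘update; lookup∘update′)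
open import Data.Vec.Relation.Unary.All as All using (All; []; _∷_)
open import Data.Vec.Relation.Unary.All.Properties using (lookup⁺)
open import Function.Base using (case_of_; id)
open import Function.Bundles using (_↣_; Injection)
open import Relation.Binary using (tri<; tri≈; tri>)
open import Relation.Binary.PropositionalEquality
open import Relation.Nullary using (¬_; yes; no; contradiction)

mutual
  Eval-deterministic : ∀ {n} {p : PR n} {xs y z} → Eval p xs y → Eval p xs z → y ≡ z
  Eval-deterministic e-zer e-zer = refl
  Eval-deterministic e-succ e-succ = refl
  Eval-deterministic e-proj e-proj = refl
  Eval-deterministic (e-comp v₁ g₁) (e-comp v₂ g₂) with refl ← EvalVec-deterministic v₁ v₂ =
    Eval-deterministic g₁ g₂
  Eval-deterministic (e-prec0 g₁) (e-prec0 g₂) = Eval-deterministic g₁ g₂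
  Eval-deterministic (e-precS r₁ h₁) (e-precS r₂ h₂) with refl ← Eval-deterministic r₁ r₂ =
    Eval-deterministic h₁ h₂
  Eval-deterministic {y = y} {z} (e-mu f₁ below₁) (e-mu f₂ below₂) with <-cmp y z
  ... | tri≈ _ y≡z _ = y≡z
  ... | tri< y<z _ _ = let (_ , ev) = below₂ y y<z in contradiction (Eval-deterministic f₁ ev) 0≢1+n
  ... | tri> _ _ z<y = let (_ , ev) = below₁ z z<y in contradiction (Eval-deterministic f₂ ev) 0≢1+n

  EvalVec-deterministic : ∀ {m n} {hs : Vec (PR n) m} {xs ys zs} →
                          EvalVec hs xs ys → EvalVec hs xs zs → ys ≡ zs
  EvalVec-deterministic ev-[] ev-[] = refl
  EvalVec-deterministic (ev-∷ e₁ v₁) (ev-∷ e₂ v₂) =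
    cong₂ _∷_ (Eval-deterministic e₁ e₂) (EvalVec-deterministic v₁ v₂)

-- Counter machines

Env : Set
Env = ℕ → ℕ

opaque
  assign : Env → ℕ → ℕ → Env
  assign σ r v j = if j ≡ᵇ r then v else σ j

  assign-≡ : ∀ σ r v → assign σ r v r ≡ v
  assign-≡ σ r v with r ≡ᵇ r in eq
  ... | true = refl
  ... | false = ⊥-elim (subst T eq (≡⇒≡ᵇ r r refl))

  assign-≢ : ∀ σ r v j → j ≢ r → assign σ r v j ≡ σ j
  assign-≢ σ r v j j≢r with j ≡ᵇ r in eq
  ... | true = ⊥-elim (j≢r (≡ᵇ⇒≡ j r (subst T (sym eq) tt)))
  ... | false = refl

AgreeExcept : Env → Env → ℕ → Set
AgreeExcept σ σ′ r = ∀ j → j ≢ r → σ′ j ≡ σ j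

assign-agreeExcept : ∀ σ r v → AgreeExcept σ (assign σ r v) r
assign-agreeExcept σ r v j = assign-≢ σ r v j

-- Fetching outside the program yields rej.
data Instr : Set where
  inc   : (r t : ℕ) → Instr
  decjz : (r t₁ t₀ : ℕ) → Instr
  jmp   : (t : ℕ) → Instr
  acc   : Instr
  rej   : Instr

fetch : List Instr → ℕ → Instr
fetch [] _ = rej
fetch (i ∷ P) zero = i
fetch (i ∷ P) (suc q) = fetch P q

execute : Instr → Env → Maybe (ℕ × Env)
execute (inc r t) σ = just (t , assign σ r (suc (σ r)))
execute (decjz r t₁ t₀) σ with σ r
... | zero  = just (t₀ , σ)
... | suc v = just (t₁ , assign σ r v)
execute (jmp t) σ = just (t , σ)
execute acc σ = nothing
execute rej σ = nothing

data Step (P : List Instr) : ℕ → Env → ℕ → Env → Set where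
  s-inc  : ∀ {q σ r t} → fetch P q ≡ inc r t → Step P q σ t (assign σ r (suc (σ r)))
  s-decS : ∀ {q σ r t₁ t₀ v} → fetch P q ≡ decjz r t₁ t₀ → σ r ≡ suc v → Step P q σ t₁ (assign σ r v)
  s-decZ : ∀ {q σ r t₁ t₀} → fetch P q ≡ decjz r t₁ t₀ → σ r ≡ 0 → Step P q σ t₀ σ
  s-jmp  : ∀ {q σ t} → fetch P q ≡ jmp t → Step P q σ t σ

data Steps (P : List Instr) : ℕ → Env → ℕ → Env → Set where
  done : ∀ {q σ} → Steps P q σ q σ
  more : ∀ {q σ q′ σ′ q″ σ″} → Step P q σ q′ σ′ → Steps P q′ σ′ q″ σ″ → Steps P q σ q″ σ″

infixr 5 _▷_
_▷_ : ∀ {P q σ q′ σ′ q″ σ″} → Steps P q σ q′ σ′ → Steps P q′ σ′ q″ σ″ → Steps P q σ q″ σ″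
done ▷ s = s
more x r ▷ s = more x (r ▷ s)

-- Address 0 is the accepting state.
ReachesAccept : List Instr → ℕ → Env → Set
ReachesAccept P q σ = Σ Env λ τ → Steps P q σ 0 τ

Step⇒execute : ∀ {P q σ q′ σ′} → Step P q σ q′ σ′ → execute (fetch P q) σ ≡ just (q′ , σ′)
Step⇒execute (s-inc eq) rewrite eq = refl
Step⇒execute (s-decS eq σr≡suc) rewrite eq | σr≡suc = refl
Step⇒execute (s-decZ eq σr≡0) rewrite eq | σr≡0 = refl
Step⇒execute (s-jmp eq) rewrite eq = refl

Step-deterministic : ∀ {P q σ q₁ σ₁ q₂ σ₂} → Step P q σ q₁ σ₁ → Step P q σ q₂ σ₂ → (q₁ , σ₁) ≡ (q₂ , σ₂)
Step-deterministic s₁ s₂ = just-injective (trans (sym (Step⇒execute s₁)) (Step⇒execute s₂))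

halted-¬Step : ∀ {P q σ q′ σ′} → execute (fetch P q) σ ≡ nothing → ¬ Step P q σ q′ σ′
halted-¬Step halted st with () ← trans (sym halted) (Step⇒execute st)

Steps-halted-unique : ∀ {P q σ q₁ σ₁ q₂ σ₂} →
  execute (fetch P q₁) σ₁ ≡ nothing → execute (fetch P q₂) σ₂ ≡ nothing →
  Steps P q σ q₁ σ₁ → Steps P q σ q₂ σ₂ → q₁ ≡ q₂
Steps-halted-unique h₁ h₂ done done = refl
Steps-halted-unique h₁ h₂ done (more st _) = ⊥-elim (halted-¬Step h₁ st)
Steps-halted-unique h₁ h₂ (more st _) done = ⊥-elim (halted-¬Step h₂ st)
Steps-halted-unique h₁ h₂ (more st₁ rest₁) (more st₂ rest₂) with refl ← Step-deterministic st₁ st₂ =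
  Steps-halted-unique h₁ h₂ rest₁ rest₂

-- Structured counter programs and their flattening

data Cmd : Set where
  skip : Cmd
  incC : ℕ → Cmd
  _⨾_  : Cmd → Cmd → Cmd
  loop : ℕ → Cmd → Cmd
infixr 4 _⨾_

data _/_⇓_ : Cmd → Env → Env → Set where
  ⇓skip  : ∀ {σ} → skip / σ ⇓ σ
  ⇓inc   : ∀ {σ r} → incC r / σ ⇓ assign σ r (suc (σ r))
  ⇓seq   : ∀ {c₁ c₂ σ σ₁ σ₂} → c₁ / σ ⇓ σ₁ → c₂ / σ₁ ⇓ σ₂ → (c₁ ⨾ c₂) / σ ⇓ σ₂
  ⇓loop0 : ∀ {r c σ} → σ r ≡ 0 → loop r c / σ ⇓ σ
  ⇓loopS : ∀ {r c σ v σ₁ σ₂} → σ r ≡ suc v → c / assign σ r v ⇓ σ₁ → loop r c / σ₁ ⇓ σ₂ →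
           loop r c / σ ⇓ σ₂

size : Cmd → ℕ
size skip = 0
size (incC r) = 1
size (c₁ ⨾ c₂) = size c₁ + size c₂
size (loop r c) = suc (suc (size c))

flatten : Cmd → ℕ → List Instr
flatten skip o = []
flatten (incC r) o = inc r (suc o) ∷ []
flatten (c₁ ⨾ c₂) o = flatten c₁ o ++ flatten c₂ (o + size c₁)
flatten (loop r c) o = decjz r (suc o) (o + size (loop r c)) ∷ (flatten c (suc o) ++ jmp o ∷ [])

length-flatten : ∀ c o → length (flatten c o) ≡ size c
length-flatten skip o = refl
length-flatten (incC r) o = refl
length-flatten (c₁ ⨾ c₂) o =
  trans (length-++ (flatten c₁ o)) (cong₂ _+_ (length-flatten c₁ o) (length-flatten c₂ _))
length-flatten (loop r c) o = cong suc (begin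
  length (flatten c (suc o) ++ jmp o ∷ [])  ≡⟨ length-++ (flatten c (suc o)) ⟩
  length (flatten c (suc o)) + 1           ≡⟨ cong (_+ 1) (length-flatten c (suc o)) ⟩
  size c + 1                               ≡⟨ +-comm (size c) 1 ⟩
  suc (size c)                             ∎)
  where open ≡-Reasoning

record LoadedAt (P : List Instr) (o : ℕ) (L : List Instr) : Set where
  constructor loadedAt
  field fetch-loaded : ∀ i → i < length L → fetch P (o + i) ≡ fetch L i
open LoadedAt

fetch-++ˡ : ∀ L₁ L₂ i → i < length L₁ → fetch (L₁ ++ L₂) i ≡ fetch L₁ i
fetch-++ˡ (x ∷ L₁) L₂ zero _ = refl
fetch-++ˡ (x ∷ L₁) L₂ (suc i) (s≤s i<) = fetch-++ˡ L₁ L₂ i i<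

fetch-++ʳ : ∀ L₁ L₂ i → fetch (L₁ ++ L₂) (length L₁ + i) ≡ fetch L₂ i
fetch-++ʳ [] L₂ i = refl
fetch-++ʳ (x ∷ L₁) L₂ i = fetch-++ʳ L₁ L₂ i

LoadedAt-++ˡ : ∀ {P o} L₁ L₂ → LoadedAt P o (L₁ ++ L₂) → LoadedAt P o L₁
LoadedAt-++ˡ L₁ L₂ (loadedAt at) = loadedAt λ i i< →
  trans (at i (<-≤-trans i< (≤-trans (m≤m+n _ _) (≤-reflexive (sym (length-++ L₁))))))
        (fetch-++ˡ L₁ L₂ i i<)

LoadedAt-++ʳ : ∀ {P o} L₁ L₂ → LoadedAt P o (L₁ ++ L₂) → LoadedAt P (o + length L₁) L₂
LoadedAt-++ʳ {P} {o} L₁ L₂ (loadedAt at) = loadedAt λ i i< →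
  trans (cong (fetch P) (+-assoc o (length L₁) i))
   (trans (at (length L₁ + i) (subst (length L₁ + i <_) (sym (length-++ L₁)) (+-monoʳ-< (length L₁) i<)))
          (fetch-++ʳ L₁ L₂ i))

LoadedAt-head : ∀ {P o x L} → LoadedAt P o (x ∷ L) → fetch P o ≡ x
LoadedAt-head {P} {o} (loadedAt at) = trans (cong (fetch P) (sym (+-identityʳ o))) (at 0 (s≤s z≤n))

LoadedAt-tail : ∀ {P o x L} → LoadedAt P o (x ∷ L) → LoadedAt P (suc o) L
LoadedAt-tail {P} {o} (loadedAt at) = loadedAt λ i i< → trans (cong (fetch P) (sym (+-suc o i))) (at (suc i) (s≤s i<))

flatten-correct : ∀ {c σ σ′} → c / σ ⇓ σ′ → ∀ P o → LoadedAt P o (flatten c o) → Steps P o σ (o + size c) σ′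
flatten-correct ⇓skip P o at rewrite +-identityʳ o = done
flatten-correct ⇓inc P o at rewrite +-comm o 1 = more (s-inc (LoadedAt-head at)) done
flatten-correct {σ = σ} {σ′} (⇓seq {c₁} {c₂} d₁ d₂) P o at =
  subst (λ z → Steps P o σ z σ′) (+-assoc o (size c₁) (size c₂))
        (flatten-correct d₁ P o at₁ ▷ flatten-correct d₂ P (o + size c₁) at₂)
  where
  at₁ : LoadedAt P o (flatten c₁ o)
  at₁ = LoadedAt-++ˡ (flatten c₁ o) (flatten c₂ (o + size c₁)) at
  at₂ : LoadedAt P (o + size c₁) (flatten c₂ (o + size c₁))
  at₂ = subst (λ z → LoadedAt P (o + z) (flatten c₂ (o + size c₁))) (length-flatten c₁ o)
              (LoadedAt-++ʳ (flatten c₁ o) (flatten c₂ (o + size c₁)) at)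
flatten-correct (⇓loop0 r≡0) P o at = more (s-decZ (LoadedAt-head at) r≡0) done
flatten-correct {loop r c} (⇓loopS r≡suc d₁ d₂) P o at =
  more (s-decS (LoadedAt-head at) r≡suc)
       (flatten-correct d₁ P (suc o) atBody ▷ more (s-jmp (LoadedAt-head atJmp)) (flatten-correct d₂ P o at))
  where
  atBody : LoadedAt P (suc o) (flatten c (suc o))
  atBody = LoadedAt-++ˡ (flatten c (suc o)) _ (LoadedAt-tail at)
  atJmp : LoadedAt P (suc o + size c) (jmp o ∷ [])
  atJmp = subst (λ z → LoadedAt P (suc o + z) (jmp o ∷ [])) (length-flatten c (suc o))
                (LoadedAt-++ʳ (flatten c (suc o)) (jmp o ∷ []) (LoadedAt-tail at))

-- Compiling μ-recursive programs to structured programs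

below-≢ : ∀ {j b} k → j < b → j ≢ k + b
below-≢ {j} {b} k j<b = <⇒≢ (<-≤-trans j<b (m≤n+m b k))

above-≢ : ∀ {j b K} k → K + b ≤ j → k < K → j ≢ k + b
above-≢ {j} {b} {K} k K+b≤j k<K j≡ = <⇒≢ (<-≤-trans (+-monoˡ-< b k<K) K+b≤j) (sym j≡)

+-cancelʳ-≢ : ∀ b {k l} → k ≢ l → k + b ≢ l + b
+-cancelʳ-≢ b k≢l eq = k≢l (+-cancelʳ-≡ b _ _ eq)

1≢2 : 1 ≢ 2
1≢2 ()

below⊎offset : ∀ j b → j < b ⊎ Σ ℕ (λ k → j ≡ k + b)
below⊎offset j b with j <? b
... | yes j<b = inj₁ j<b
... | no j≮b = inj₂ (j ∸ b , sym (m∸n+n≡m (≮⇒≥ j≮b)))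

map-cong-All : ∀ {n} (f g : ℕ → ℕ) (xs : Vec ℕ n) → All (λ x → f x ≡ g x) xs → vmap f xs ≡ vmap g xs
map-cong-All f g [] [] = refl
map-cong-All f g (x ∷ xs) (p ∷ ps) = cong₂ _∷_ p (map-cong-All f g xs ps)

clear : ℕ → Cmd
clear r = loop r skip

move : ℕ → ℕ → Cmd
move r s = loop r (incC s)

move2 : ℕ → ℕ → ℕ → Cmd
move2 r s t = loop r (incC s ⨾ incC t)

-- Adds register i to out, using t (initially zero) to restore i.
addTo : ℕ → ℕ → ℕ → Cmd
addTo i out t = move2 i out t ⨾ move t i

clear-correct : ∀ r σ → Σ Env λ σ′ → (clear r / σ ⇓ σ′) × (σ′ r ≡ 0) × AgreeExcept σ σ′ r
clear-correct r σ = go (σ r) σ refl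
  where
  go : ∀ k σ → σ r ≡ k → Σ Env λ σ′ → (clear r / σ ⇓ σ′) × (σ′ r ≡ 0) × AgreeExcept σ σ′ r
  go zero σ r≡ = σ , ⇓loop0 r≡ , r≡ , λ j _ → refl
  go (suc k) σ r≡ =
    let (σ′ , d , r≡0 , agree) = go k (assign σ r k) (assign-≡ σ r k)
    in σ′ , ⇓loopS r≡ ⇓skip d , r≡0 , λ j j≢r → trans (agree j j≢r) (assign-≢ σ r k j j≢r)

move-correct : ∀ r s → r ≢ s → ∀ σ →
  Σ Env λ σ′ → (move r s / σ ⇓ σ′) × (σ′ r ≡ 0) × (σ′ s ≡ σ s + σ r)
             × (∀ j → j ≢ r → j ≢ s → σ′ j ≡ σ j)
move-correct r s r≢s σ = go (σ r) σ refl
  where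
  go : ∀ k σ → σ r ≡ k →
    Σ Env λ σ′ → (move r s / σ ⇓ σ′) × (σ′ r ≡ 0) × (σ′ s ≡ σ s + k)
               × (∀ j → j ≢ r → j ≢ s → σ′ j ≡ σ j)
  go zero σ r≡ = σ , ⇓loop0 r≡ , r≡ , sym (+-identityʳ _) , λ j _ _ → refl
  go (suc k) σ r≡ =
    let σ₀ = assign σ r k
        (σ′ , d , r≡0 , s≡ , others) = go k (assign σ₀ s (suc (σ₀ s))) (trans (assign-≢ _ s _ r r≢s) (assign-≡ σ r k))
        s-inc : assign σ₀ s (suc (σ₀ s)) s ≡ suc (σ s)
        s-inc = trans (assign-≡ σ₀ s _) (cong suc (assign-≢ σ r k s (≢-sym r≢s)))
    in σ′ , ⇓loopS r≡ ⇓inc d , r≡0 ,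
       trans s≡ (trans (cong (_+ k) s-inc) (sym (+-suc _ k))) ,
       λ j j≢r j≢s → trans (others j j≢r j≢s) (trans (assign-≢ _ s _ j j≢s) (assign-≢ σ r k j j≢r))

move2-correct : ∀ r s t → r ≢ s → r ≢ t → s ≢ t → ∀ σ →
  Σ Env λ σ′ → (move2 r s t / σ ⇓ σ′) × (σ′ r ≡ 0) × (σ′ s ≡ σ s + σ r) × (σ′ t ≡ σ t + σ r)
             × (∀ j → j ≢ r → j ≢ s → j ≢ t → σ′ j ≡ σ j)
move2-correct r s t r≢s r≢t s≢t σ = go (σ r) σ refl
  where
  go : ∀ k σ → σ r ≡ k →
    Σ Env λ σ′ → (move2 r s t / σ ⇓ σ′) × (σ′ r ≡ 0) × (σ′ s ≡ σ s + k) × (σ′ t ≡ σ t + k)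
               × (∀ j → j ≢ r → j ≢ s → j ≢ t → σ′ j ≡ σ j)
  go zero σ r≡ = σ , ⇓loop0 r≡ , r≡ , sym (+-identityʳ _) , sym (+-identityʳ _) , λ j _ _ _ → refl
  go (suc k) σ r≡ =
    let σ₀ = assign σ r k
        σ₁ = assign σ₀ s (suc (σ₀ s))
        σ₂ = assign σ₁ t (suc (σ₁ t))
        (σ′ , d , r≡0 , s≡ , t≡ , others) =
          go k σ₂ (trans (assign-≢ _ t _ r r≢t) (trans (assign-≢ _ s _ r r≢s) (assign-≡ σ r k)))
        s-inc : σ₂ s ≡ suc (σ s)
        s-inc = trans (assign-≢ σ₁ t _ s s≢t) (trans (assign-≡ σ₀ s _) (cong suc (assign-≢ σ r k s (≢-sym r≢s))))
        t-inc : σ₂ t ≡ suc (σ t)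
        t-inc = trans (assign-≡ σ₁ t _)
                      (cong suc (trans (assign-≢ σ₀ s _ t (≢-sym s≢t)) (assign-≢ σ r k t (≢-sym r≢t))))
    in σ′ , ⇓loopS r≡ (⇓seq ⇓inc ⇓inc) d , r≡0 ,
       trans s≡ (trans (cong (_+ k) s-inc) (sym (+-suc _ k))) ,
       trans t≡ (trans (cong (_+ k) t-inc) (sym (+-suc _ k))) ,
       λ j j≢r j≢s j≢t → trans (others j j≢r j≢s j≢t)
         (trans (assign-≢ _ t _ j j≢t) (trans (assign-≢ _ s _ j j≢s) (assign-≢ σ r k j j≢r)))

addTo-correct : ∀ i out t → i ≢ out → i ≢ t → out ≢ t → ∀ σ → σ t ≡ 0 →
  Σ Env λ σ′ → (addTo i out t / σ ⇓ σ′) × (σ′ out ≡ σ out + σ i) × AgreeExcept σ σ′ out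
addTo-correct i out t i≢out i≢t out≢t σ t≡0
  with σ₁ , d₁ , i≡0 , out≡ , t≡ , others₁ ← move2-correct i out t i≢out i≢t out≢t σ
  with σ₂ , d₂ , t≡0′ , i≡ , others₂ ← move-correct t i (≢-sym i≢t) σ₁ =
  σ₂ , ⇓seq d₁ d₂ , trans (others₂ out out≢t (≢-sym i≢out)) out≡ , agree
  where
  agree : AgreeExcept σ σ₂ out
  agree j j≢out with j ≟ i | j ≟ t
  ... | yes refl | _ = trans i≡ (cong₂ _+_ i≡0 (trans t≡ (cong (_+ σ j) t≡0)))
  ... | no _ | yes refl = trans t≡0′ (sym t≡0)
  ... | no j≢i | no j≢t = trans (others₂ j j≢t j≢i) (others₁ j j≢i j≢out j≢t)

range : ℕ → (m : ℕ) → Vec ℕ m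
range s zero = []
range s (suc m) = s ∷ range (suc s) m

clearRange : ℕ → ℕ → Cmd
clearRange s zero = skip
clearRange s (suc m) = clear s ⨾ clearRange (suc s) m

-- compilePR p ins out b reads the arguments of p from the registers ins, adds the result to
-- register out, and uses the registers from b on as scratch space.
mutual
  compilePR : ∀ {n} → PR n → Vec ℕ n → ℕ → ℕ → Cmd
  compilePR zer ins out b = skip
  compilePR succ (i ∷ []) out b = addTo i out b ⨾ incC out
  compilePR (proj k) ins out b = addTo (lookup ins k) out b
  compilePR (comp {m} g hs) ins out b =
    compilePRs hs ins b (b + m) ⨾ (compilePR g (range b m) out (b + m) ⨾ clearRange b m)
  compilePR (prec g h) (ix ∷ ixs) out b =
    addTo ix b (1 + b) ⨾ (compilePR g ixs (1 + b) (3 + b) ⨾ (loop b (precBody h ixs b) ⨾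
    (move (1 + b) out ⨾ clear (2 + b))))
  compilePR (mu f) ixs out b =
    incC b ⨾ (loop b (muBody f ixs b) ⨾ move (1 + b) out)

  compilePRs : ∀ {n m} → Vec (PR n) m → Vec ℕ n → ℕ → ℕ → Cmd
  compilePRs [] ins s b = skip
  compilePRs (h ∷ hs) ins s b = compilePR h ins s b ⨾ compilePRs hs ins (suc s) b

  -- Registers b, 1 + b, 2 + b hold the remaining iterations, the accumulator and the index.
  precBody : ∀ {n} → PR (suc (suc n)) → Vec ℕ n → ℕ → Cmd
  precBody h ixs b =
    compilePR h (2 + b ∷ 1 + b ∷ ixs) (3 + b) (4 + b) ⨾ (clear (1 + b) ⨾ (move (3 + b) (1 + b) ⨾ incC (2 + b)))

  -- Registers b, 1 + b, 2 + b hold the continue flag, the candidate and the value of f;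
  -- the inner loop runs iff the value is nonzero, and then sets the flag and advances the candidate.
  muBody : ∀ {n} → PR (suc n) → Vec ℕ n → ℕ → Cmd
  muBody f ixs b =
    compilePR f (1 + b ∷ ixs) (2 + b) (3 + b) ⨾ loop (2 + b) (clear (2 + b) ⨾ (incC (1 + b) ⨾ incC b))

CompilesCorrectly : ∀ {n} → PR n → Set
CompilesCorrectly {n} p = ∀ {xs y} → Eval p xs y → ∀ (ins : Vec ℕ n) out b σ → (∀ j → b ≤ j → σ j ≡ 0) →
  All (_< b) ins → out < b → All (_≢ out) ins → vmap σ ins ≡ xs →
  Σ Env λ σ′ → (compilePR p ins out b / σ ⇓ σ′) × (σ′ out ≡ σ out + y) × AgreeExcept σ σ′ out

zer-correct : ∀ {n} → CompilesCorrectly (zer {n})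
zer-correct e-zer ins out b σ _ _ _ _ _ = σ , ⇓skip , sym (+-identityʳ _) , λ j _ → refl

succ-correct : CompilesCorrectly succ
succ-correct {x ∷ []} e-succ (i ∷ []) out b σ zero≥b (i<b ∷ []) out<b (i≢out ∷ []) refl
  with σ₁ , d₁ , out≡ , agree ← addTo-correct i out b i≢out (<⇒≢ i<b) (<⇒≢ out<b) σ (zero≥b b ≤-refl) =
  assign σ₁ out (suc (σ₁ out)) , ⇓seq d₁ ⇓inc ,
  trans (assign-≡ σ₁ out _) (trans (cong suc out≡) (sym (+-suc _ _))) ,
  λ j j≢out → trans (assign-≢ σ₁ out _ j j≢out) (agree j j≢out)

proj-correct : ∀ {n} (k : Fin n) → CompilesCorrectly (proj k)
proj-correct k e-proj ins out b σ zero≥b ins<b out<b ins≢out refl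
  with σ₁ , d₁ , out≡ , agree ← addTo-correct (lookup ins k) out b (lookup⁺ ins≢out k) (<⇒≢ (lookup⁺ ins<b k))
                                              (<⇒≢ out<b) σ (zero≥b b ≤-refl) =
  σ₁ , d₁ , trans out≡ (cong (σ out +_) (sym (lookup-map k σ ins))) , agree

clearRange-correct : ∀ s m σ →
  Σ Env λ σ′ → (clearRange s m / σ ⇓ σ′) × (∀ j → s ≤ j → j < s + m → σ′ j ≡ 0)
             × (∀ j → j < s → σ′ j ≡ σ j) × (∀ j → s + m ≤ j → σ′ j ≡ σ j)
clearRange-correct s zero σ =
  σ , ⇓skip , (λ j s≤j j<s → ⊥-elim (<⇒≱ j<s (subst (_≤ j) (sym (+-identityʳ s)) s≤j))) ,
  (λ _ _ → refl) , λ _ _ → refl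
clearRange-correct s (suc m) σ
  with σ₁ , d₁ , s≡0 , agree ← clear-correct s σ
  with σ₂ , d₂ , cleared , below , above ← clearRange-correct (suc s) m σ₁ =
  σ₂ , ⇓seq d₁ d₂ , cleared′ , below′ , above′
  where
  cleared′ : ∀ j → s ≤ j → j < s + suc m → σ₂ j ≡ 0
  cleared′ j s≤j j< with j ≟ s
  ... | yes refl = trans (below j ≤-refl) s≡0
  ... | no j≢s = cleared j (≤∧≢⇒< s≤j (≢-sym j≢s)) (subst (j <_) (+-suc s m) j<)
  below′ : ∀ j → j < s → σ₂ j ≡ σ j
  below′ j j<s = trans (below j (m≤n⇒m≤1+n j<s)) (agree j (<⇒≢ j<s))
  above′ : ∀ j → s + suc m ≤ j → σ₂ j ≡ σ j
  above′ j ≤j = trans (above j (subst (_≤ j) (+-suc s m) ≤j))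
                      (agree j (≢-sym (<⇒≢ (<-≤-trans (m<m+n s {suc m} (s≤s z≤n)) ≤j))))

range-bounds : ∀ s m → All (λ x → (s ≤ x) × (x < s + m)) (range s m)
range-bounds s zero = []
range-bounds s (suc m) =
  (≤-refl , m<m+n s (s≤s z≤n)) ∷
  All.map (λ { {x} (s<x , x<) → <⇒≤ s<x , subst (x <_) (sym (+-suc s m)) x< }) (range-bounds (suc s) m)

compilePRs-correct : ∀ {n m} (hs : Vec (PR n) m) → All CompilesCorrectly hs → ∀ {xs ys} → EvalVec hs xs ys →
  ∀ ins s b τ → s + m ≤ b → (∀ j → s ≤ j → τ j ≡ 0) → All (_< s) ins → vmap τ ins ≡ xs →
  Σ Env λ τ′ → (compilePRs hs ins s b / τ ⇓ τ′) × (∀ j → j < s → τ′ j ≡ τ j)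
             × (vmap τ′ (range s m) ≡ ys) × (∀ j → s + m ≤ j → τ′ j ≡ 0)
compilePRs-correct [] [] ev-[] ins s b τ _ zero≥s _ _ =
  τ , ⇓skip , (λ _ _ → refl) , refl , λ j ≤j → zero≥s j (≤-trans (m≤m+n s 0) ≤j)
compilePRs-correct {m = suc m} (h ∷ hs) (ok-h ∷ ok-hs) (ev-∷ {y = y} ev-h ev-hs) ins s b τ s+m≤b zero≥s ins<s ins≡
  with τ₁ , d₁ , s≡ , agree ← ok-h ev-h ins s b τ (λ j b≤j → zero≥s j (≤-trans (≤-trans (m≤m+n s (suc m)) s+m≤b) b≤j))
                                 (All.map (λ i<s → <-≤-trans i<s (≤-trans (m≤m+n s (suc m)) s+m≤b)) ins<s)
                                 (<-≤-trans (m<m+n s (s≤s z≤n)) s+m≤b) (All.map <⇒≢ ins<s) ins≡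
  with τ₂ , d₂ , below , results , above ←
         compilePRs-correct hs ok-hs ev-hs ins (suc s) b τ₁ (subst (_≤ b) (+-suc s m) s+m≤b)
           (λ j s<j → trans (agree j (≢-sym (<⇒≢ s<j))) (zero≥s j (<⇒≤ s<j)))
           (All.map m≤n⇒m≤1+n ins<s)
           (trans (map-cong-All τ₁ τ ins (All.map (λ i<s → agree _ (<⇒≢ i<s)) ins<s)) ins≡) =
  τ₂ , ⇓seq d₁ d₂ , (λ j j<s → trans (below j (m≤n⇒m≤1+n j<s)) (agree j (<⇒≢ j<s))) ,
  cong₂ _∷_ (trans (below s ≤-refl) (trans s≡ (cong (_+ y) (zero≥s s ≤-refl)))) results ,
  λ j ≤j → above j (subst (_≤ j) (+-suc s m) ≤j)

comp-correct : ∀ {n m} (g : PR m) (hs : Vec (PR n) m) → CompilesCorrectly g → All CompilesCorrectly hs →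
               CompilesCorrectly (comp g hs)
comp-correct {n} {m} g hs ok-g ok-hs (e-comp {y = y} ev-hs ev-g) ins out b σ zero≥b ins<b out<b _ ins≡
  with σ₁ , d₁ , below₁ , results , above₁ ← compilePRs-correct hs ok-hs ev-hs ins b (b + m) σ ≤-refl zero≥b ins<b ins≡
  with σ₂ , d₂ , out≡ , agree₂ ← ok-g ev-g (range b m) out (b + m) σ₁ above₁
         (All.map proj₂ (range-bounds b m)) (<-≤-trans out<b (m≤m+n b m))
         (All.map (λ (b≤x , _) x≡out → <⇒≢ (<-≤-trans out<b b≤x) (sym x≡out)) (range-bounds b m))
         results
  with σ₃ , d₃ , cleared , below₃ , above₃ ← clearRange-correct b m σ₂ =
  σ₃ , ⇓seq d₁ (⇓seq d₂ d₃) ,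
  trans (below₃ out out<b) (trans out≡ (cong (_+ y) (below₁ out out<b))) , agree
  where
  agree : AgreeExcept σ σ₃ out
  agree j j≢out with j <? b | j <? b + m
  ... | yes j<b | _ = trans (below₃ j j<b) (trans (agree₂ j j≢out) (below₁ j j<b))
  ... | no j≮b | yes j<b+m = trans (cleared j (≮⇒≥ j≮b) j<b+m) (sym (zero≥b j (≮⇒≥ j≮b)))
  ... | no j≮b | no j≮b+m =
    trans (above₃ j (≮⇒≥ j≮b+m)) (trans (agree₂ j j≢out) (trans (above₁ j (≮⇒≥ j≮b+m)) (sym (zero≥b j (≮⇒≥ j≮b)))))

-- The loops of prec and mu keep their state in the scratch registers b, 1 + b and 2 + b.
record Frame (σ : Env) (b : ℕ) (τ : Env) (v₀ v₁ v₂ : ℕ) : Set where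
  constructor frame
  field
    low   : ∀ j → j < b → τ j ≡ σ j
    slot₀ : τ b ≡ v₀
    slot₁ : τ (1 + b) ≡ v₁
    slot₂ : τ (2 + b) ≡ v₂
    high  : ∀ j → 3 + b ≤ j → τ j ≡ 0
open Frame

Frame-init : ∀ {σ b} → (∀ j → b ≤ j → σ j ≡ 0) → Frame σ b σ 0 0 0
Frame-init {σ} {b} zero≥b =
  frame (λ _ _ → refl) (zero≥b b ≤-refl) (zero≥b _ (m≤n+m b 1)) (zero≥b _ (m≤n+m b 2))
        (λ j ≤j → zero≥b j (≤-trans (m≤n+m b 3) ≤j))

Frame-set₀ : ∀ {σ b τ τ′ v₀ v₁ v₂ w} → Frame σ b τ v₀ v₁ v₂ → τ′ b ≡ w → AgreeExcept τ τ′ b →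
             Frame σ b τ′ w v₁ v₂
Frame-set₀ {b = b} fr w≡ agree = frame
  (λ j j<b → trans (agree j (below-≢ 0 j<b)) (low fr j j<b)) w≡
  (trans (agree _ (+-cancelʳ-≢ b (≢-sym 0≢1+n))) (slot₁ fr))
  (trans (agree _ (+-cancelʳ-≢ b (≢-sym 0≢1+n))) (slot₂ fr))
  (λ j ≤j → trans (agree j (above-≢ {K = 3} 0 ≤j (s≤s z≤n))) (high fr j ≤j))

Frame-set₁ : ∀ {σ b τ τ′ v₀ v₁ v₂ w} → Frame σ b τ v₀ v₁ v₂ → τ′ (1 + b) ≡ w → AgreeExcept τ τ′ (1 + b) →
             Frame σ b τ′ v₀ w v₂
Frame-set₁ {b = b} fr w≡ agree = frame
  (λ j j<b → trans (agree j (below-≢ 1 j<b)) (low fr j j<b))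
  (trans (agree _ (+-cancelʳ-≢ b 0≢1+n)) (slot₀ fr)) w≡
  (trans (agree _ (+-cancelʳ-≢ b (≢-sym 1≢2))) (slot₂ fr))
  (λ j ≤j → trans (agree j (above-≢ {K = 3} 1 ≤j (s≤s (s≤s z≤n)))) (high fr j ≤j))

Frame-set₂ : ∀ {σ b τ τ′ v₀ v₁ v₂ w} → Frame σ b τ v₀ v₁ v₂ → τ′ (2 + b) ≡ w → AgreeExcept τ τ′ (2 + b) →
             Frame σ b τ′ v₀ v₁ w
Frame-set₂ {b = b} fr w≡ agree = frame
  (λ j j<b → trans (agree j (below-≢ 2 j<b)) (low fr j j<b))
  (trans (agree _ (+-cancelʳ-≢ b 0≢1+n)) (slot₀ fr))
  (trans (agree _ (+-cancelʳ-≢ b 1≢2)) (slot₁ fr)) w≡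
  (λ j ≤j → trans (agree j (above-≢ {K = 3} 2 ≤j (s≤s (s≤s (s≤s z≤n))))) (high fr j ≤j))

Frame-inc₀ : ∀ {σ b τ v₀ v₁ v₂} → Frame σ b τ v₀ v₁ v₂ → Frame σ b (assign τ b (suc (τ b))) (suc v₀) v₁ v₂
Frame-inc₀ {b = b} {τ} fr = Frame-set₀ fr (trans (assign-≡ τ b _) (cong suc (slot₀ fr))) (assign-agreeExcept τ b _)

Frame-inc₁ : ∀ {σ b τ v₀ v₁ v₂} → Frame σ b τ v₀ v₁ v₂ →
             Frame σ b (assign τ (1 + b) (suc (τ (1 + b)))) v₀ (suc v₁) v₂
Frame-inc₁ {b = b} {τ} fr =
  Frame-set₁ fr (trans (assign-≡ τ (1 + b) _) (cong suc (slot₁ fr))) (assign-agreeExcept τ (1 + b) _)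

Frame-release : ∀ {σ b τ out} → (∀ j → b ≤ j → σ j ≡ 0) → (∀ j → j < b → j ≢ out → τ j ≡ σ j) →
                τ b ≡ 0 → τ (1 + b) ≡ 0 → τ (2 + b) ≡ 0 → (∀ j → 3 + b ≤ j → τ j ≡ 0) → AgreeExcept σ τ out
Frame-release {σ} {b} {τ} {out} zero≥b below e₀ e₁ e₂ above j j≢out with below⊎offset j b
... | inj₁ j<b = below j j<b j≢out
... | inj₂ (0 , refl) = trans e₀ (sym (zero≥b b ≤-refl))
... | inj₂ (1 , refl) = trans e₁ (sym (zero≥b _ (m≤n+m b 1)))
... | inj₂ (2 , refl) = trans e₂ (sym (zero≥b _ (m≤n+m b 2)))
... | inj₂ (suc (suc (suc k)) , refl) = trans (above _ (s≤s (s≤s (s≤s (m≤n+m b k))))) (sym (zero≥b _ (m≤n+m b _)))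

above-≢-out : ∀ {out b j} K → out < b → K + b ≤ j → j ≢ out
above-≢-out {out} {b} K out<b ≤j j≡out = <⇒≢ (<-≤-trans out<b (≤-trans (m≤n+m b K) ≤j)) (sym j≡out)

Eval-prec-below : ∀ {n} {g : PR n} {h xs} i k {y} → Eval (prec g h) (i + k ∷ xs) y → Σ ℕ λ z → Eval (prec g h) (i ∷ xs) z
Eval-prec-below i zero {y} ev rewrite +-identityʳ i = y , ev
Eval-prec-below i (suc k) ev rewrite +-suc i k with e-precS ev′ _ ← ev = Eval-prec-below i k ev′

Eval-prec-suc : ∀ {n} {g : PR n} {h xs y z} i k →
                Eval (prec g h) (suc (i + k) ∷ xs) y → Eval (prec g h) (i ∷ xs) z →
                Σ ℕ λ z′ → Eval h (i ∷ z ∷ xs) z′ × Eval (prec g h) (suc i ∷ xs) z′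
Eval-prec-suc {h = h} {xs} i k ev-final ev-i with z′ , e-precS ev-i′ ev-h ← Eval-prec-below (suc i) k ev-final =
  z′ , subst (λ u → Eval h (i ∷ u ∷ xs) z′) (Eval-deterministic ev-i′ ev-i) ev-h , e-precS ev-i′ ev-h

module PrecLoop {n} (g : PR n) (h : PR (suc (suc n))) (ok-h : CompilesCorrectly h) {xs : Vec ℕ n} {y : ℕ}
  (ixs : Vec ℕ n) (b : ℕ) (σ : Env) (ixs<b : All (_< b) ixs) (xs≡ : vmap σ ixs ≡ xs) where

  precBody-correct : ∀ τ k z i z′ → Frame σ b τ k z i → Eval h (i ∷ z ∷ xs) z′ →
                     Σ Env λ τ′ → (precBody h ixs b / τ ⇓ τ′) × Frame σ b τ′ k z′ (suc i)
  precBody-correct τ k z i z′ fr ev-h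
    with τ₁ , d₁ , r₃≡ , agree₁ ←
           ok-h ev-h (2 + b ∷ 1 + b ∷ ixs) (3 + b) (4 + b) τ (λ j ≤j → high fr j (≤-trans (n≤1+n _) ≤j))
             (+-monoˡ-< b (s≤s (s≤s (s≤s z≤n))) ∷ +-monoˡ-< b (s≤s (s≤s z≤n)) ∷
              All.map (λ i<b → <-≤-trans i<b (m≤n+m b 4)) ixs<b)
             ≤-refl (+-cancelʳ-≢ b {2} {3} (λ ()) ∷ +-cancelʳ-≢ b {1} {3} (λ ()) ∷ All.map (below-≢ 3) ixs<b)
             (cong₂ _∷_ (slot₂ fr) (cong₂ _∷_ (slot₁ fr) (trans (map-cong-All τ σ ixs (All.map (low fr _) ixs<b)) xs≡)))
    with τ₂ , d₂ , r₁≡0 , agree₂ ← clear-correct (1 + b) τ₁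
    with τ₃ , d₃ , r₃≡0 , r₁≡ , others₃ ← move-correct (3 + b) (1 + b) (+-cancelʳ-≢ b {3} {1} (λ ())) τ₂ =
    τ₄ , ⇓seq d₁ (⇓seq d₂ (⇓seq d₃ ⇓inc)) , frame low′ slot₀′ slot₁′ slot₂′ high′
    where
    τ₄ : Env
    τ₄ = assign τ₃ (2 + b) (suc (τ₃ (2 + b)))
    unchanged₃ : ∀ j → j ≢ 1 + b → j ≢ 3 + b → τ₃ j ≡ τ j
    unchanged₃ j j≢1 j≢3 = trans (others₃ j j≢3 j≢1) (trans (agree₂ j j≢1) (agree₁ j j≢3))
    unchanged₄ : ∀ j → j ≢ 1 + b → j ≢ 2 + b → j ≢ 3 + b → τ₄ j ≡ τ j
    unchanged₄ j j≢1 j≢2 j≢3 = trans (assign-≢ τ₃ _ _ j j≢2) (unchanged₃ j j≢1 j≢3)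
    low′ : ∀ j → j < b → τ₄ j ≡ σ j
    low′ j j<b = trans (unchanged₄ j (below-≢ 1 j<b) (below-≢ 2 j<b) (below-≢ 3 j<b)) (low fr j j<b)
    slot₀′ : τ₄ b ≡ k
    slot₀′ = trans (unchanged₄ b (+-cancelʳ-≢ b {0} {1} (λ ())) (+-cancelʳ-≢ b {0} {2} (λ ()))
                                 (+-cancelʳ-≢ b {0} {3} (λ ()))) (slot₀ fr)
    slot₁′ : τ₄ (1 + b) ≡ z′
    slot₁′ = trans (assign-≢ τ₃ _ _ (1 + b) (+-cancelʳ-≢ b {1} {2} (λ ())))
               (trans r₁≡ (cong₂ _+_ r₁≡0 (trans (agree₂ (3 + b) (+-cancelʳ-≢ b {3} {1} (λ ())))
                 (trans r₃≡ (cong (_+ z′) (high fr (3 + b) ≤-refl))))))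
    slot₂′ : τ₄ (2 + b) ≡ suc i
    slot₂′ = trans (assign-≡ τ₃ _ _)
               (cong suc (trans (unchanged₃ (2 + b) (+-cancelʳ-≢ b {2} {1} (λ ())) (+-cancelʳ-≢ b {2} {3} (λ ())))
                                (slot₂ fr)))
    high′ : ∀ j → 3 + b ≤ j → τ₄ j ≡ 0
    high′ j ≤j with j ≟ 3 + b
    ... | yes refl = trans (assign-≢ τ₃ _ _ (3 + b) (+-cancelʳ-≢ b {3} {2} (λ ()))) r₃≡0
    ... | no j≢3 = trans (unchanged₄ j (above-≢ 1 ≤j (s≤s (s≤s z≤n))) (above-≢ 2 ≤j (s≤s (s≤s (s≤s z≤n)))) j≢3)
                         (high fr j ≤j)

  precLoop-correct : ∀ k i z τ → Frame σ b τ k z i → Eval (prec g h) (i ∷ xs) z → Eval (prec g h) (i + k ∷ xs) y →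
                     Σ Env λ τ′ → (loop b (precBody h ixs b) / τ ⇓ τ′) × Frame σ b τ′ 0 y (i + k)
  precLoop-correct zero i z τ fr ev-i ev-final =
    τ , ⇓loop0 (slot₀ fr) ,
    subst₂ (Frame σ b τ 0)
      (Eval-deterministic ev-i (subst (λ u → Eval (prec g h) (u ∷ xs) y) (+-identityʳ i) ev-final))
      (sym (+-identityʳ i)) fr
  precLoop-correct (suc k) i z τ fr ev-i ev-final =
    let ev-final′ = subst (λ u → Eval (prec g h) (u ∷ xs) y) (+-suc i k) ev-final
        (z′ , ev-h , ev-suc-i) = Eval-prec-suc i k ev-final′ ev-i
        (τ₁ , d₁ , fr₁) = precBody-correct (assign τ b k) k z i z′
                            (Frame-set₀ fr (assign-≡ τ b k) (assign-agreeExcept τ b k)) ev-h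
        (τ′ , d′ , fr′) = precLoop-correct k (suc i) z′ τ₁ fr₁ ev-suc-i ev-final′
    in τ′ , ⇓loopS (slot₀ fr) d₁ d′ , subst (Frame σ b τ′ 0 y) (sym (+-suc i k)) fr′

prec-correct : ∀ {n} (g : PR n) (h : PR (suc (suc n))) → CompilesCorrectly g → CompilesCorrectly h →
               CompilesCorrectly (prec g h)
prec-correct g h ok-g ok-h {x ∷ xs} {y} ev (ix ∷ ixs) out b σ zero≥b (ix<b ∷ ixs<b) out<b _ ins≡
  with x≡ , xs≡ ← ∷-injective ins≡
  with σ₁ , d₁ , b≡ , agree₁ ← addTo-correct ix b (1 + b) (below-≢ 0 ix<b) (below-≢ 1 ix<b)
                                 (+-cancelʳ-≢ b {0} {1} (λ ())) σ (zero≥b _ (m≤n+m b 1))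
  with frame₁ ← Frame-set₀ (Frame-init zero≥b) (trans b≡ (cong₂ _+_ (zero≥b b ≤-refl) x≡)) agree₁
  with z₀ , e-prec0 ev-g ← Eval-prec-below 0 x ev
  with σ₂ , d₂ , acc≡ , agree₂ ←
         ok-g ev-g ixs (1 + b) (3 + b) σ₁ (high frame₁)
           (All.map (λ i<b → <-≤-trans i<b (m≤n+m b 3)) ixs<b) (+-monoˡ-< b (s≤s (s≤s z≤n)))
           (All.map (below-≢ 1) ixs<b) (trans (map-cong-All σ₁ σ ixs (All.map (low frame₁ _) ixs<b)) xs≡)
  with frame₂ ← Frame-set₁ frame₁ (trans acc≡ (cong (_+ z₀) (slot₁ frame₁))) agree₂
  with σ₃ , d₃ , frame₃ ← PrecLoop.precLoop-correct g h ok-h ixs b σ ixs<b xs≡ x 0 z₀ σ₂ frame₂ (e-prec0 ev-g) ev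
  with σ₄ , d₄ , r₁≡0 , out≡ , others₄ ← move-correct (1 + b) out (≢-sym (below-≢ 1 out<b)) σ₃
  with σ₅ , d₅ , r₂≡0 , agree₅ ← clear-correct (2 + b) σ₄ =
  σ₅ , ⇓seq d₁ (⇓seq d₂ (⇓seq d₃ (⇓seq d₄ d₅))) ,
  trans (agree₅ out (below-≢ 2 out<b)) (trans out≡ (cong₂ _+_ (low frame₃ out out<b) (slot₁ frame₃))) ,
  Frame-release zero≥b
    (λ j j<b j≢out → trans (agree₅ j (below-≢ 2 j<b)) (trans (others₄ j (below-≢ 1 j<b) j≢out) (low frame₃ j j<b)))
    (trans (agree₅ b (+-cancelʳ-≢ b {0} {2} (λ ())))
           (trans (others₄ b (+-cancelʳ-≢ b {0} {1} (λ ())) (≢-sym (below-≢ 0 out<b))) (slot₀ frame₃)))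
    (trans (agree₅ _ (+-cancelʳ-≢ b {1} {2} (λ ()))) r₁≡0) r₂≡0
    (λ j ≤j → trans (agree₅ j (above-≢ 2 ≤j (s≤s (s≤s (s≤s z≤n)))))
                    (trans (others₄ j (above-≢ 1 ≤j (s≤s (s≤s z≤n))) (above-≢-out 3 out<b ≤j)) (high frame₃ j ≤j)))

module MuLoop {n} (f : PR (suc n)) (ok-f : CompilesCorrectly f) {xs : Vec ℕ n} {y : ℕ}
  (f-zero : Eval f (y ∷ xs) 0) (f-pos : ∀ i → i < y → Σ ℕ λ z → Eval f (i ∷ xs) (suc z))
  (ixs : Vec ℕ n) (b : ℕ) (σ : Env) (ixs<b : All (_< b) ixs) (xs≡ : vmap σ ixs ≡ xs) where

  callF-correct : ∀ τ i v → Frame σ b τ 0 i 0 → Eval f (i ∷ xs) v →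
                  Σ Env λ τ′ → (compilePR f (1 + b ∷ ixs) (2 + b) (3 + b) / τ ⇓ τ′) × Frame σ b τ′ 0 i v
  callF-correct τ i v fr ev-f
    with τ₁ , d₁ , r₂≡ , agree₁ ←
           ok-f ev-f (1 + b ∷ ixs) (2 + b) (3 + b) τ (high fr)
             (+-monoˡ-< b (s≤s (s≤s z≤n)) ∷ All.map (λ i<b → <-≤-trans i<b (m≤n+m b 3)) ixs<b)
             ≤-refl (+-cancelʳ-≢ b {1} {2} (λ ()) ∷ All.map (below-≢ 2) ixs<b)
             (cong₂ _∷_ (slot₁ fr) (trans (map-cong-All τ σ ixs (All.map (low fr _) ixs<b)) xs≡)) =
    τ₁ , d₁ , Frame-set₂ fr (trans r₂≡ (cong (_+ v) (slot₂ fr))) agree₁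

  muLoop-correct : ∀ k i τ → i + k ≡ y → Frame σ b τ 1 i 0 →
                   Σ Env λ τ′ → (loop b (muBody f ixs b) / τ ⇓ τ′) × Frame σ b τ′ 0 y 0
  muLoop-correct zero i τ i≡y fr =
    let i≡y′ = trans (sym (+-identityʳ i)) i≡y
        (τ₁ , d₁ , fr₁) = callF-correct (assign τ b 0) i 0 (Frame-set₀ fr (assign-≡ τ b 0) (assign-agreeExcept τ b 0))
                                        (subst (λ u → Eval f (u ∷ xs) 0) (sym i≡y′) f-zero)
    in τ₁ , ⇓loopS (slot₀ fr) (⇓seq d₁ (⇓loop0 (slot₂ fr₁))) (⇓loop0 (slot₀ fr₁)) ,
       subst (λ u → Frame σ b τ₁ 0 u 0) i≡y′ fr₁
  muLoop-correct (suc k) i τ i+k≡y fr =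
    let (z , ev-f) = f-pos i (subst (i <_) i+k≡y (m<m+n i (s≤s z≤n)))
        (τ₁ , d₁ , fr₁) = callF-correct (assign τ b 0) i (suc z)
                            (Frame-set₀ fr (assign-≡ τ b 0) (assign-agreeExcept τ b 0)) ev-f
        (τ₂ , d₂ , r₂≡0 , agree₂) = clear-correct (2 + b) (assign τ₁ (2 + b) z)
        τ₃ = assign τ₂ (1 + b) (suc (τ₂ (1 + b)))
        τ₄ = assign τ₃ b (suc (τ₃ b))
        fr₄ : Frame σ b τ₄ 1 (suc i) 0
        fr₄ = Frame-inc₀ (Frame-inc₁ (Frame-set₂ (Frame-set₂ fr₁ (assign-≡ τ₁ (2 + b) z) (assign-agreeExcept τ₁ _ _))
                                                 r₂≡0 agree₂))
        (τ′ , d′ , fr′) = muLoop-correct k (suc i) τ₄ (trans (sym (+-suc i k)) i+k≡y) fr₄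
    in τ′ , ⇓loopS (slot₀ fr) (⇓seq d₁ (⇓loopS (slot₂ fr₁) (⇓seq d₂ (⇓seq ⇓inc ⇓inc)) (⇓loop0 (slot₂ fr₄)))) d′ ,
       fr′

mu-correct : ∀ {n} (f : PR (suc n)) → CompilesCorrectly f → CompilesCorrectly (mu f)
mu-correct f ok-f {xs} {y} (e-mu f-zero f-pos) ixs out b σ zero≥b ixs<b out<b _ xs≡
  with σ₃ , d₃ , frame₃ ← MuLoop.muLoop-correct f ok-f f-zero f-pos ixs b σ ixs<b xs≡ y 0 (assign σ b (suc (σ b)))
                             refl (Frame-inc₀ (Frame-init zero≥b))
  with σ₄ , d₄ , r₁≡0 , out≡ , others₄ ← move-correct (1 + b) out (≢-sym (below-≢ 1 out<b)) σ₃ =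
  σ₄ , ⇓seq ⇓inc (⇓seq d₃ d₄) , trans out≡ (cong₂ _+_ (low frame₃ out out<b) (slot₁ frame₃)) ,
  Frame-release zero≥b (λ j j<b j≢out → trans (others₄ j (below-≢ 1 j<b) j≢out) (low frame₃ j j<b))
    (trans (others₄ b (+-cancelʳ-≢ b {0} {1} (λ ())) (≢-sym (below-≢ 0 out<b))) (slot₀ frame₃)) r₁≡0
    (trans (others₄ (2 + b) (+-cancelʳ-≢ b {2} {1} (λ ())) (≢-sym (below-≢ 2 out<b))) (slot₂ frame₃))
    (λ j ≤j → trans (others₄ j (above-≢ 1 ≤j (s≤s (s≤s z≤n))) (above-≢-out 3 out<b ≤j)) (high frame₃ j ≤j))

mutual
  compilePR-correct : ∀ {n} (p : PR n) → CompilesCorrectly p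
  compilePR-correct zer = zer-correct
  compilePR-correct succ = succ-correct
  compilePR-correct (proj k) = proj-correct k
  compilePR-correct (comp g hs) = comp-correct g hs (compilePR-correct g) (compilePR-correct* hs)
  compilePR-correct (prec g h) = prec-correct g h (compilePR-correct g) (compilePR-correct h)
  compilePR-correct (mu f) = mu-correct f (compilePR-correct f)

  compilePR-correct* : ∀ {n m} (hs : Vec (PR n) m) → All CompilesCorrectly hs
  compilePR-correct* [] = []
  compilePR-correct* (h ∷ hs) = compilePR-correct h ∷ compilePR-correct* hs

-- Counters encoded by pairs of sets of data values

module _ {𝔻 : Set} where
  open LM using () renaming (_∈_ to _∈ₗ_)

  data Distinct : List 𝔻 → Set where
    []  : Distinct []
    _∷_ : ∀ {x l} → ¬ (x ∈ₗ l) → Distinct l → Distinct (x ∷ l)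

  remove : ∀ {d} (l : List 𝔻) → d ∈ₗ l → List 𝔻
  remove (x ∷ l) (here _) = l
  remove (x ∷ l) (there p) = x ∷ remove l p

  remove-length : ∀ {d} (l : List 𝔻) (p : d ∈ₗ l) → length l ≡ suc (length (remove l p))
  remove-length (x ∷ l) (here _) = refl
  remove-length (x ∷ l) (there p) = cong suc (remove-length l p)

  remove-⊆ : ∀ {d e} (l : List 𝔻) (p : d ∈ₗ l) → e ∈ₗ remove l p → e ∈ₗ l
  remove-⊆ (x ∷ l) (here _) q = there q
  remove-⊆ (x ∷ l) (there p) (here q) = here q
  remove-⊆ (x ∷ l) (there p) (there q) = there (remove-⊆ l p q)

  remove-split : ∀ {d e} (l : List 𝔻) (p : d ∈ₗ l) → e ∈ₗ l → (e ≡ d) ⊎ (e ∈ₗ remove l p)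
  remove-split (x ∷ l) (here d≡x) (here e≡x) = inj₁ (trans e≡x (sym d≡x))
  remove-split (x ∷ l) (there p) (here e≡x) = inj₂ (here e≡x)
  remove-split (x ∷ l) (here _) (there q) = inj₂ q
  remove-split (x ∷ l) (there p) (there q) = Data.Sum.map₂ there (remove-split l p q)

  remove-Distinct : ∀ {d} (l : List 𝔻) (p : d ∈ₗ l) → Distinct l → Distinct (remove l p)
  remove-Distinct (x ∷ l) (here _) (_ ∷ dl) = dl
  remove-Distinct (x ∷ l) (there p) (x∉l ∷ dl) = (λ q → x∉l (remove-⊆ l p q)) ∷ remove-Distinct l p dl

  remove-∉ : ∀ {d} (l : List 𝔻) (p : d ∈ₗ l) → Distinct l → ¬ (d ∈ₗ remove l p)
  remove-∉ (x ∷ l) (here d≡x) (x∉l ∷ _) q = x∉l (subst (_∈ₗ l) d≡x q)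
  remove-∉ (x ∷ l) (there p) (x∉l ∷ _) (here d≡x) = x∉l (subst (_∈ₗ l) d≡x p)
  remove-∉ (x ∷ l) (there p) (_ ∷ dl) (there q) = remove-∉ l p dl q

  record Encodes (X Y : 𝔻 → Set) (v : ℕ) : Set where
    constructor encodes
    field
      diff        : List 𝔻
      length-diff : length diff ≡ v
      distinct    : Distinct diff
      X⊆Y∪diff    : ∀ e → X e → Y e ⊎ e ∈ₗ diff
      Y⊆X         : ∀ e → Y e → X e
      diff⊆X      : ∀ e → e ∈ₗ diff → X e
      diff∩Y≡∅    : ∀ e → e ∈ₗ diff → ¬ Y e

  Encodes-cong : ∀ {X Y X′ Y′ v} → Encodes X Y v →
                 (∀ e → X′ e → X e) → (∀ e → X e → X′ e) → (∀ e → Y′ e → Y e) → (∀ e → Y e → Y′ e) →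
                 Encodes X′ Y′ v
  Encodes-cong (encodes l len dl X⊆ Y⊆ l⊆ l∩) X′⊆X X⊆X′ Y′⊆Y Y⊆Y′ = encodes l len dl
    (λ e x → Data.Sum.map₁ (Y⊆Y′ e) (X⊆ e (X′⊆X e x)))
    (λ e y → X⊆X′ e (Y⊆ e (Y′⊆Y e y)))
    (λ e p → X⊆X′ e (l⊆ e p))
    (λ e p y → l∩ e p (Y′⊆Y e y))

  Encodes-add-X : ∀ {X Y X′ Y′ v d} → Encodes X Y v → ¬ X d →
                  (∀ e → X′ e → X e ⊎ e ≡ d) → (∀ e → X e → X′ e) → X′ d →
                  (∀ e → Y′ e → Y e) → (∀ e → Y e → Y′ e) → Encodes X′ Y′ (suc v)
  Encodes-add-X {X′ = X′} {Y′} {d = d} (encodes l len dl X⊆ Y⊆ l⊆ l∩) d∉X X′⊆ X⊆X′ d∈X′ Y′⊆Y Y⊆Y′ =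
    encodes (d ∷ l) (cong suc len) ((λ p → d∉X (l⊆ d p)) ∷ dl) X⊆′ (λ e y → X⊆X′ e (Y⊆ e (Y′⊆Y e y))) l⊆′ l∩′
    where
    X⊆′ : ∀ e → X′ e → Y′ e ⊎ e ∈ₗ (d ∷ l)
    X⊆′ e x with X′⊆ e x
    ... | inj₂ refl = inj₂ (here refl)
    ... | inj₁ xe = Data.Sum.map (Y⊆Y′ e) there (X⊆ e xe)
    l⊆′ : ∀ e → e ∈ₗ (d ∷ l) → X′ e
    l⊆′ e (here refl) = d∈X′
    l⊆′ e (there p) = X⊆X′ e (l⊆ e p)
    l∩′ : ∀ e → e ∈ₗ (d ∷ l) → ¬ Y′ e
    l∩′ e (here refl) y = d∉X (Y⊆ e (Y′⊆Y e y))
    l∩′ e (there p) y = l∩ e p (Y′⊆Y e y)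

  Encodes-add-Y : ∀ {X Y X′ Y′ v d} → Encodes X Y v → X d → ¬ Y d →
                  (∀ e → X′ e → X e) → (∀ e → X e → X′ e) →
                  (∀ e → Y′ e → Y e ⊎ e ≡ d) → (∀ e → Y e → Y′ e) → Y′ d →
                  Σ ℕ λ v′ → (v ≡ suc v′) × Encodes X′ Y′ v′
  Encodes-add-Y {X′ = X′} {Y′} {d = d} (encodes l len dl X⊆ Y⊆ l⊆ l∩) d∈X d∉Y X′⊆X X⊆X′ Y′⊆ Y⊆Y′ d∈Y′
    with X⊆ d d∈X
  ... | inj₁ d∈Y = ⊥-elim (d∉Y d∈Y)
  ... | inj₂ p =
    length (remove l p) , trans (sym len) (remove-length l p) ,
    encodes (remove l p) refl (remove-Distinct l p dl) X⊆′ Y⊆′ (λ e q → X⊆X′ e (l⊆ e (remove-⊆ l p q))) l∩′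
    where
    X⊆′ : ∀ e → X′ e → Y′ e ⊎ e ∈ₗ remove l p
    X⊆′ e x with X⊆ e (X′⊆X e x)
    ... | inj₁ y = inj₁ (Y⊆Y′ e y)
    ... | inj₂ q with remove-split l p q
    ...   | inj₁ refl = inj₁ d∈Y′
    ...   | inj₂ q′ = inj₂ q′
    Y⊆′ : ∀ e → Y′ e → X′ e
    Y⊆′ e y with Y′⊆ e y
    ... | inj₁ y′ = X⊆X′ e (Y⊆ e y′)
    ... | inj₂ refl = X⊆X′ e d∈X
    l∩′ : ∀ e → e ∈ₗ remove l p → ¬ Y′ e
    l∩′ e q y with Y′⊆ e y
    ... | inj₁ y′ = l∩ e (remove-⊆ l p q) y′
    ... | inj₂ refl = remove-∉ l p dl q

  Encodes-⊆⇒0 : ∀ {X Y v} → Encodes X Y v → (∀ e → X e → Y e) → v ≡ 0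
  Encodes-⊆⇒0 (encodes [] len _ _ _ _ _) X⊆Y = sym len
  Encodes-⊆⇒0 (encodes (x ∷ l) _ _ _ _ l⊆ l∩) X⊆Y = ⊥-elim (l∩ x (here refl) (X⊆Y x (l⊆ x (here refl))))

  Encodes-suc⇒∃ : ∀ {X Y v} → Encodes X Y (suc v) → Σ 𝔻 λ d → X d × ¬ Y d
  Encodes-suc⇒∃ (encodes [] () _ _ _ _ _)
  Encodes-suc⇒∃ (encodes (x ∷ l) _ _ _ _ l⊆ l∩) = x , l⊆ x (here refl) , l∩ x (here refl)

  Encodes-0⇒⊆ : ∀ {X Y} → Encodes X Y 0 → ∀ e → X e → Y e
  Encodes-0⇒⊆ (encodes [] _ _ X⊆ _ _ _) e x with X⊆ e x
  ... | inj₁ y = y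
  ... | inj₂ ()
  Encodes-0⇒⊆ (encodes (_ ∷ _) () _ _ _ _ _)

clamp : ∀ {n} → ℕ → Fin (suc n)
clamp {zero} _ = fz
clamp {suc n} zero = fz
clamp {suc n} (suc q) = fs (clamp {n} q)

toℕ-clamp : ∀ {n} q → q < suc n → toℕ (clamp {n} q) ≡ q
toℕ-clamp {zero} zero _ = refl
toℕ-clamp {zero} (suc q) (s≤s ())
toℕ-clamp {suc n} zero _ = refl
toℕ-clamp {suc n} (suc q) (s≤s lt) = cong suc (toℕ-clamp q lt)

clamp-toℕ : ∀ {n} (i : Fin (suc n)) → clamp {n} (toℕ i) ≡ i
clamp-toℕ {zero} fz = refl
clamp-toℕ {zero} (fs ())
clamp-toℕ {suc n} fz = refl
clamp-toℕ {suc n} (fs i) = cong fs (clamp-toℕ i)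

Bounded : ℕ → ℕ → Instr → Set
Bounded M n (inc r t) = r < M × t < n
Bounded M n (decjz r t1 t0) = r < M × t1 < n × t0 < n
Bounded M n (jmp t) = t < n
Bounded M n acc = ⊤
Bounded M n rej = ⊤

-- Counter r < M is represented by the registers X r and Y r; its value is the size of X r ∖ Y r.
module Registers (M' : ℕ) where
  M m : ℕ
  M = suc M'
  m = M + M

  X : ℕ → Fin m
  X r = clamp {M'} r ↑ˡ M
  Y : ℕ → Fin m
  Y r = M ↑ʳ clamp {M'} r

  keepAll : Vec (Subset m) m
  keepAll = tabulate ⁅_⁆
  noEqTest : Vec (Subset m) m
  noEqTest = replicate m ∅
  eqTest : ℕ → Vec (Subset m) m
  eqTest r = noEqTest [ X r ]≔ ⁅ Y r ⁆

  toX : ∀ r → r < M → toℕ (X r) ≡ r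
  toX r lt = trans (toℕ-↑ˡ (clamp {M'} r) M) (toℕ-clamp r lt)

  X≢Y : ∀ r r' → X r ≢ Y r'
  X≢Y r r' e = <⇒≢ (<-≤-trans (toℕ<n (clamp {M'} r)) (m≤m+n M _))
                  (trans (sym (toℕ-↑ˡ (clamp {M'} r) M)) (trans (cong toℕ e) (toℕ-↑ʳ M (clamp {M'} r'))))

  X-inj : ∀ {r r'} → r < M → r' < M → X r ≡ X r' → r ≡ r'
  X-inj {r} {r'} l l' e = trans (sym (toX r l)) (trans (cong toℕ e) (toX r' l'))

  Y-inj : ∀ {r r'} → r < M → r' < M → Y r ≡ Y r' → r ≡ r'
  Y-inj {r} {r'} l l' e = trans (sym (toℕ-clamp {M'} r l))
     (trans (+-cancelˡ-≡ M _ _ (trans (sym (toℕ-↑ʳ M (clamp {M'} r))) (trans (cong toℕ e) (toℕ-↑ʳ M (clamp {M'} r')))))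
       (toℕ-clamp r' l'))

  ∈keepAll⇒≡ : ∀ {r′ r} → r′ ∈ lookup keepAll r → r′ ≡ r
  ∈keepAll⇒≡ {r′} {r} p = x∈⁅y⁆⇒x≡y r (subst (r′ ∈_) (lookup∘tabulate ⁅_⁆ r) p)

  keepAll∋ : ∀ r → r ∈ lookup keepAll r
  keepAll∋ r = subst (r ∈_) (sym (lookup∘tabulate ⁅_⁆ r)) (x∈⁅x⁆ r)

  ∉noEqTest : ∀ {r′} r → r′ ∉ lookup noEqTest r
  ∉noEqTest {r′} r p = ∉⊥ (subst (r′ ∈_) (lookup-replicate r ∅) p)

-- inc r adds a fresh datum to X r, dec r adds a datum of X r ∖ Y r to Y r, and the zero
-- test is X r = Y r. Only the first letter is read, and addresses are clamped into range.
module CounterRSA (k n' M' : ℕ) where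
  open Registers M' public

  Tr : Set
  Tr = Transition k (suc n') m

  incTransition decTransition zeroTransition : ℕ → ℕ → ℕ → Tr
  incTransition s r t = mkTransition (clamp s) fz ∅ ⁅ X r ⁆ noEqTest keepAll ⁅ X r ⁆ (clamp t)
  decTransition s r t = mkTransition (clamp s) fz ⁅ X r ⁆ ⁅ Y r ⁆ noEqTest keepAll ⁅ Y r ⁆ (clamp t)
  zeroTransition s r t = mkTransition (clamp s) fz ∅ ∅ (eqTest r) keepAll ∅ (clamp t)

  jmpTransition : ℕ → ℕ → Tr
  jmpTransition s t = mkTransition (clamp s) fz ∅ ∅ noEqTest keepAll ∅ (clamp t)

  instrTransitions : ℕ → Instr → List Tr
  instrTransitions s (inc r t) = incTransition s r t ∷ []
  instrTransitions s (decjz r t₁ t₀) = decTransition s r t₁ ∷ zeroTransition s r t₀ ∷ []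
  instrTransitions s (jmp t) = jmpTransition s t ∷ []
  instrTransitions s acc = []
  instrTransitions s rej = []

  transitionsOf : List Instr → List ℕ → List Tr
  transitionsOf P [] = []
  transitionsOf P (s ∷ ss) = instrTransitions s (fetch P s) ++ transitionsOf P ss

  Δ : List Instr → List Tr
  Δ P = transitionsOf P (downFrom (suc n'))

  WellFormed : List Instr → Set
  WellFormed P = ∀ s → s < suc n' → Bounded M (suc n') (fetch P s)

  toRSA : List Instr → ℕ → RSA k
  toRSA P start = mkRSA (suc n') m (Δ P) ⁅ clamp start ⁆ ⁅ fz ⁆

  module Simulation (𝔻 : Set) where
    R : Set₁
    R = Regs 𝔻 m

    Simulates : R → Env → Set
    Simulates f σ = ∀ r → r < M → Encodes (f (X r)) (f (Y r)) (σ r)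

    addInput : Subset m → 𝔻 → R → R
    addInput ui d f reg e = (Σ (Fin m) λ r′ → r′ ∈ lookup keepAll reg × f r′ e) ⊎ (reg ∈ ui × e ≡ d)

    addInput⁻ : ∀ {ui d f reg e} → addInput ui d f reg e → f reg e ⊎ (reg ∈ ui × e ≡ d)
    addInput⁻ {f = f} {e = e} (inj₁ (r′ , p , fe)) = inj₁ (subst (λ z → f z e) (∈keepAll⇒≡ p) fe)
    addInput⁻ (inj₂ x) = inj₂ x

    addInput⁺ : ∀ {ui d f reg e} → f reg e → addInput ui d f reg e
    addInput⁺ {reg = reg} fe = inj₁ (reg , keepAll∋ reg , fe)

    addInput-∉ : ∀ {ui d f reg e} → reg ∉ ui → addInput ui d f reg e → f reg e
    addInput-∉ {ui} {d} {f} {reg} {e} nin u with addInput⁻ {ui} {d} {f} {reg} {e} u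
    ... | inj₁ fe = fe
    ... | inj₂ (p , _) = ⊥-elim (nin p)

    addInput-∅ : ∀ {d f reg e} → addInput ∅ d f reg e → f reg e
    addInput-∅ {d} {f} = addInput-∉ {f = f} ∉⊥

    X∉⁅X⁆ : ∀ {r r'} → r < M → r' < M → r' ≢ r → X r' ∉ ⁅ X r ⁆
    X∉⁅X⁆ {r} l l' ne p = ne (X-inj l' l (x∈⁅y⁆⇒x≡y (X r) p))
    Y∉⁅X⁆ : ∀ {r r'} → Y r' ∉ ⁅ X r ⁆
    Y∉⁅X⁆ {r} {r'} p = X≢Y r r' (sym (x∈⁅y⁆⇒x≡y (X r) p))
    X∉⁅Y⁆ : ∀ {r r'} → X r' ∉ ⁅ Y r ⁆
    X∉⁅Y⁆ {r} {r'} p = X≢Y r' r (x∈⁅y⁆⇒x≡y (Y r) p)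
    Y∉⁅Y⁆ : ∀ {r r'} → r < M → r' < M → r' ≢ r → Y r' ∉ ⁅ Y r ⁆
    Y∉⁅Y⁆ {r} l l' ne p = ne (Y-inj l' l (x∈⁅y⁆⇒x≡y (Y r) p))

    Simulates-cong : ∀ {f f′ σ} → (∀ reg e → f′ reg e → f reg e) → (∀ reg e → f reg e → f′ reg e) →
                     Simulates f σ → Simulates f′ σ
    Simulates-cong f′⊆f f⊆f′ sim r r<M = Encodes-cong (sim r r<M) (f′⊆f _) (f⊆f′ _) (f′⊆f _) (f⊆f′ _)

    Simulates-keep : ∀ {f σ d} → Simulates f σ → Simulates (addInput ∅ d f) σ
    Simulates-keep {f} = Simulates-cong (λ reg e → addInput-∅ {f = f} {reg = reg} {e = e})
                                        (λ reg e → addInput⁺ {f = f} {reg = reg} {e = e})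

    Simulates-inc : ∀ {f σ d r} → r < M → ¬ f (X r) d → Simulates f σ →
                    Simulates (addInput ⁅ X r ⁆ d f) (assign σ r (suc (σ r)))
    Simulates-inc {f} {σ} {d} {r} r<M d∉X sim r′ r′<M with r′ ≟ r
    ... | yes refl = subst (Encodes _ _) (sym (assign-≡ σ r _))
          (Encodes-add-X (sim r r<M) d∉X (λ e u → Data.Sum.map₂ proj₂ (addInput⁻ {f = f} u)) (λ e → addInput⁺ {f = f})
             (inj₂ (x∈⁅x⁆ (X r) , refl)) (λ e → addInput-∉ {f = f} Y∉⁅X⁆) (λ e → addInput⁺ {f = f}))
    ... | no r′≢r = subst (Encodes _ _) (sym (assign-≢ σ r _ r′ r′≢r))
          (Encodes-cong (sim r′ r′<M) (λ e → addInput-∉ {f = f} (X∉⁅X⁆ r<M r′<M r′≢r)) (λ e → addInput⁺ {f = f})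
                                      (λ e → addInput-∉ {f = f} Y∉⁅X⁆) (λ e → addInput⁺ {f = f}))

    Simulates-dec : ∀ {f σ d r} → r < M → f (X r) d → ¬ f (Y r) d → Simulates f σ →
                    Σ ℕ λ v → (σ r ≡ suc v) × Simulates (addInput ⁅ Y r ⁆ d f) (assign σ r v)
    Simulates-dec {f} {σ} {d} {r} r<M d∈X d∉Y sim
      with v , σr≡ , enc ← Encodes-add-Y {X′ = addInput ⁅ Y r ⁆ d f (X r)} {Y′ = addInput ⁅ Y r ⁆ d f (Y r)}
                              (sim r r<M) d∈X d∉Y (λ e → addInput-∉ {f = f} X∉⁅Y⁆) (λ e → addInput⁺ {f = f})
                              (λ e u → Data.Sum.map₂ proj₂ (addInput⁻ {f = f} u)) (λ e → addInput⁺ {f = f})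
                              (inj₂ (x∈⁅x⁆ (Y r) , refl)) = v , σr≡ , sim′
      where
      sim′ : Simulates (addInput ⁅ Y r ⁆ d f) (assign σ r v)
      sim′ r′ r′<M with r′ ≟ r
      ... | yes refl = subst (Encodes _ _) (sym (assign-≡ σ r _)) enc
      ... | no r′≢r = subst (Encodes _ _) (sym (assign-≢ σ r _ r′ r′≢r))
          (Encodes-cong (sim r′ r′<M) (λ e → addInput-∉ {f = f} X∉⁅Y⁆) (λ e → addInput⁺ {f = f})
                                      (λ e → addInput-∉ {f = f} (Y∉⁅Y⁆ r<M r′<M r′≢r)) (λ e → addInput⁺ {f = f}))

    Any-transitionsOf⁻ : ∀ {Pr : Tr → Set} P ss → Any Pr (transitionsOf P ss) →
                         Σ ℕ λ s → (s LM.∈ ss) × Any Pr (instrTransitions s (fetch P s))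
    Any-transitionsOf⁻ P (s ∷ ss) any with ++⁻ (instrTransitions s (fetch P s)) any
    ... | inj₁ any′ = s , here refl , any′
    ... | inj₂ any′ with s′ , s′∈ , any″ ← Any-transitionsOf⁻ P ss any′ = s′ , there s′∈ , any″

    Any-transitionsOf⁺ : ∀ {Pr : Tr → Set} P ss s → s LM.∈ ss → Any Pr (instrTransitions s (fetch P s)) →
                         Any Pr (transitionsOf P ss)
    Any-transitionsOf⁺ P (s ∷ ss) s (here refl) any = ++⁺ˡ any
    Any-transitionsOf⁺ P (s′ ∷ ss) s (there s∈) any = ++⁺ʳ (instrTransitions s′ (fetch P s′)) (Any-transitionsOf⁺ P ss s s∈ any)

    run⇒ReachesAccept : ∀ P → WellFormed P → ∀ w (i : Fin (suc n')) f σ → RunFrom {𝔻} (Δ P) ⁅ fz ⁆ w i f →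
                        Simulates f σ → ReachesAccept P (toℕ i) σ
    run⇒ReachesAccept P wf [] i f σ run sim rewrite x∈⁅y⁆⇒x≡y fz run = σ , done
    run⇒ReachesAccept P wf ((_ , d) ∷ w) i f σ run sim
      with s , s∈ , any ← Any-transitionsOf⁻ P (downFrom (suc n')) run = byInstr (fetch P s) refl any
      where
      s< : s < suc n'
      s< = ∈-downFrom⁻ s∈
      back : ∀ {t σ′} → clamp {n'} s ≡ i → t < suc n' → Step P s σ t σ′ →
             ReachesAccept P (toℕ (clamp {n'} t)) σ′ → ReachesAccept P (toℕ i) σ
      back {t} {σ′} s≡i t< st reach =
        subst (λ z → ReachesAccept P z σ) (trans (sym (toℕ-clamp s s<)) (cong toℕ s≡i))
          (let (τ , steps) = subst (λ z → ReachesAccept P z σ′) (toℕ-clamp t t<) reach in τ , more st steps)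
      byInstr : (ins : Instr) → fetch P s ≡ ins → Any _ (instrTransitions s ins) → ReachesAccept P (toℕ i) σ
      byInstr (inc r t) eq (here (s≡i , _ , (_ , guard∉ , _) , run′)) =
        let (r< , t<) = subst (Bounded M (suc n')) eq (wf s s<)
        in back s≡i t< (s-inc eq)
             (run⇒ReachesAccept P wf w (clamp t) _ _ run′ (Simulates-inc r< (guard∉ (X r) (x∈⁅x⁆ (X r))) sim))
      byInstr (decjz r t₁ t₀) eq (here (s≡i , _ , (guard∈ , guard∉ , _) , run′))
        with r< , t₁< , _ ← subst (Bounded M (suc n')) eq (wf s s<)
        with v , σr≡ , sim′ ← Simulates-dec r< (guard∈ (X r) (x∈⁅x⁆ _)) (guard∉ (Y r) (x∈⁅x⁆ _)) sim =
        back s≡i t₁< (s-decS eq σr≡) (run⇒ReachesAccept P wf w (clamp t₁) _ _ run′ sim′)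
      byInstr (decjz r t₁ t₀) eq (there (here (s≡i , _ , (_ , _ , guard≡) , run′)))
        with r< , _ , t₀< ← subst (Bounded M (suc n')) eq (wf s s<) =
        let Y∈eq = subst (Y r ∈_) (sym (lookup∘update (X r) noEqTest ⁅ Y r ⁆)) (x∈⁅x⁆ (Y r))
            σr≡0 = Encodes-⊆⇒0 (sim r r<) (λ e x → proj₂ (guard≡ (X r) (Y r) Y∈eq e) x)
        in back s≡i t₀< (s-decZ eq σr≡0) (run⇒ReachesAccept P wf w (clamp t₀) _ σ run′ (Simulates-keep sim))
      byInstr (jmp t) eq (here (s≡i , _ , _ , run′)) =
        back s≡i (subst (Bounded M (suc n')) eq (wf s s<)) (s-jmp eq)
             (run⇒ReachesAccept P wf w (clamp t) _ σ run′ (Simulates-keep sim))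

    module Completeness (inj : ℕ ↣ 𝔻) where
      ι : ℕ → 𝔻
      ι = Injection.to inj
      ι-inj : ∀ {x y} → ι x ≡ ι y → x ≡ y
      ι-inj = Injection.injective inj

      Fresh : R → ℕ → Set
      Fresh f t = ∀ reg e → f reg e → Σ ℕ λ j → (j < t) × (e ≡ ι j)

      Word : Set
      Word = List (Fin (suc k) × 𝔻)

      eqTest-holds : ∀ (f : R) r → (∀ e → f (X r) e → f (Y r) e) → (∀ e → f (Y r) e → f (X r) e) →
                     ∀ r₁ r₂ → r₂ ∈ lookup (eqTest r) r₁ → ∀ e → (f r₂ e → f r₁ e) × (f r₁ e → f r₂ e)
      eqTest-holds f r X⊆Y Y⊆X r₁ r₂ r₂∈ e with r₁ ≟ᶠ X r
      ... | yes refl =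
        let r₂≡Y = x∈⁅y⁆⇒x≡y (Y r) (subst (r₂ ∈_) (lookup∘update (X r) noEqTest ⁅ Y r ⁆) r₂∈)
        in (λ y → Y⊆X e (subst (λ z → f z e) r₂≡Y y)) , (λ x → subst (λ z → f z e) (sym r₂≡Y) (X⊆Y e x))
      ... | no r₁≢X =
        ⊥-elim (∉noEqTest r₁ (subst (r₂ ∈_) (lookup∘update′ {i = r₁} {j = X r} r₁≢X noEqTest ⁅ Y r ⁆) r₂∈))

      incTransition-enabled : ∀ (f : R) r d s t → ¬ f (X r) d → Enabled (incTransition s r t) d f
      incTransition-enabled f r d s t d∉X =
        (λ r₁ p → ⊥-elim (∉⊥ p)) , (λ r₁ p x → d∉X (subst (λ z → f z d) (x∈⁅y⁆⇒x≡y _ p) x)) ,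
        (λ r₁ r₂ p → ⊥-elim (∉noEqTest r₁ p))

      decTransition-enabled : ∀ (f : R) r d s t → f (X r) d → ¬ f (Y r) d → Enabled (decTransition s r t) d f
      decTransition-enabled f r d s t d∈X d∉Y =
        (λ r₁ p → subst (λ z → f z d) (sym (x∈⁅y⁆⇒x≡y _ p)) d∈X) ,
        (λ r₁ p y → d∉Y (subst (λ z → f z d) (x∈⁅y⁆⇒x≡y _ p) y)) ,
        (λ r₁ r₂ p → ⊥-elim (∉noEqTest r₁ p))

      zeroTransition-enabled : ∀ (f : R) r d s t → (∀ e → f (X r) e → f (Y r) e) → (∀ e → f (Y r) e → f (X r) e) →
                               Enabled (zeroTransition s r t) d f
      zeroTransition-enabled f r d s t X⊆Y Y⊆X =
        (λ r₁ p → ⊥-elim (∉⊥ p)) , (λ r₁ p → ⊥-elim (∉⊥ p)) , eqTest-holds f r X⊆Y Y⊆X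

      jmpTransition-enabled : ∀ (f : R) d s t → Enabled (jmpTransition s t) d f
      jmpTransition-enabled f d s t =
        (λ r₁ p → ⊥-elim (∉⊥ p)) , (λ r₁ p → ⊥-elim (∉⊥ p)) , (λ r₁ r₂ p → ⊥-elim (∉noEqTest r₁ p))

      FiresTo : List Instr → Fin (suc n') → Fin (suc k) → 𝔻 → R → Word → Tr → Set
      FiresTo P i a d f w t = (Transition.source t ≡ i) × (Transition.letter t ≡ a) × Enabled t d f ×
                          RunFrom (Δ P) ⁅ fz ⁆ w (Transition.target t) (update t d f)

      fire : ∀ {P q ins i a d f w} → fetch P q ≡ ins → toℕ i ≡ q → Any (FiresTo P i a d f w) (instrTransitions q ins) →
             RunFrom {𝔻} (Δ P) ⁅ fz ⁆ ((a , d) ∷ w) i f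
      fire {P} {q} {i = i} refl refl any = Any-transitionsOf⁺ P (downFrom (suc n')) q (∈-downFrom⁺ (toℕ<n i)) any

      clamp-source : ∀ {q} (i : Fin (suc n')) → toℕ i ≡ q → clamp q ≡ i
      clamp-source i refl = clamp-toℕ i

      Fresh-∉ : ∀ {f t} reg → Fresh f t → ¬ f reg (ι t)
      Fresh-∉ reg fresh x = let (j , j< , e) = fresh reg _ x in <⇒≢ j< (sym (ι-inj e))

      Fresh-inc : ∀ {f t} r → Fresh f t → Fresh (addInput ⁅ X r ⁆ (ι t) f) (suc t)
      Fresh-inc {f} {t} r fresh reg e u with addInput⁻ {f = f} u
      ... | inj₁ x = let (j , j< , e≡) = fresh reg e x in j , m≤n⇒m≤1+n j< , e≡
      ... | inj₂ (_ , refl) = t , ≤-refl , refl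

      Fresh-dec : ∀ {f t d} r → f (X r) d → Fresh f t → Fresh (addInput ⁅ Y r ⁆ d f) t
      Fresh-dec {f} r d∈X fresh reg e u with addInput⁻ {f = f} u
      ... | inj₁ x = fresh reg e x
      ... | inj₂ (_ , refl) = fresh (X r) e d∈X

      Fresh-keep : ∀ {f t d} → Fresh f t → Fresh (addInput ∅ d f) t
      Fresh-keep {f} fresh reg e u = fresh reg e (addInput-∅ {f = f} u)

      -- The accepted word reads the fresh datum ι t at each inc and a datum of X r ∖ Y r at each dec.
      Steps⇒run : ∀ P → WellFormed P → ∀ {q σ τ} → Steps P q σ 0 τ → ∀ (i : Fin (suc n')) f t → toℕ i ≡ q →
                  Simulates f σ → Fresh f t → Σ Word λ w → RunFrom {𝔻} (Δ P) ⁅ fz ⁆ w i f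
      Steps⇒run P wf done i f t i≡q sim fresh =
        [] , subst (_∈ ⁅ fz ⁆) (sym (toℕ-injective {i = i} {j = fz} i≡q)) (x∈⁅x⁆ fz)
      Steps⇒run P wf {q} (more (s-inc {r = r} {t = t′} eq) rest) i f t i≡q sim fresh =
        let (r< , t′<) = subst (Bounded M (suc n')) eq (wf q (subst (_< suc n') i≡q (toℕ<n i)))
            d∉X = Fresh-∉ (X r) fresh
            (w , run) = Steps⇒run P wf rest (clamp t′) _ (suc t) (toℕ-clamp t′ t′<)
                                  (Simulates-inc r< d∉X sim) (Fresh-inc r fresh)
        in (fz , ι t) ∷ w ,
           fire eq i≡q (here (clamp-source i i≡q , refl , incTransition-enabled f r (ι t) q t′ d∉X , run))
      Steps⇒run P wf {q} {σ} (more (s-decS {r = r} {t₁ = t₁} {v = v} eq σr≡) rest) i f t i≡q sim fresh =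
        let (r< , t₁< , _) = subst (Bounded M (suc n')) eq (wf q (subst (_< suc n') i≡q (toℕ<n i)))
            (d , d∈X , d∉Y) = Encodes-suc⇒∃ (subst (Encodes _ _) σr≡ (sim r r<))
            (v′ , σr≡′ , sim′) = Simulates-dec r< d∈X d∉Y sim
            v′≡v = suc-injective (trans (sym σr≡′) σr≡)
            (w , run) = Steps⇒run P wf rest (clamp t₁) _ t (toℕ-clamp t₁ t₁<)
                                  (subst (λ z → Simulates (addInput ⁅ Y r ⁆ d f) (assign σ r z)) v′≡v sim′)
                                  (Fresh-dec r d∈X fresh)
        in (fz , d) ∷ w ,
           fire eq i≡q (here (clamp-source i i≡q , refl , decTransition-enabled f r d q t₁ d∈X d∉Y , run))
      Steps⇒run P wf {q} {σ} (more (s-decZ {r = r} {t₀ = t₀} eq σr≡0) rest) i f t i≡q sim fresh =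
        let (r< , _ , t₀<) = subst (Bounded M (suc n')) eq (wf q (subst (_< suc n') i≡q (toℕ<n i)))
            enc = subst (Encodes _ _) σr≡0 (sim r r<)
            (w , run) = Steps⇒run P wf rest (clamp t₀) _ t (toℕ-clamp t₀ t₀<) (Simulates-keep sim) (Fresh-keep fresh)
            enabled = zeroTransition-enabled f r (ι t) q t₀ (Encodes-0⇒⊆ enc) (Encodes.Y⊆X enc)
        in (fz , ι t) ∷ w , fire eq i≡q (there (here (clamp-source i i≡q , refl , enabled , run)))
      Steps⇒run P wf {q} {σ} (more (s-jmp {t = t′} eq) rest) i f t i≡q sim fresh =
        let t′< = subst (Bounded M (suc n')) eq (wf q (subst (_< suc n') i≡q (toℕ<n i)))
            (w , run) = Steps⇒run P wf rest (clamp t′) _ t (toℕ-clamp t′ t′<) (Simulates-keep sim) (Fresh-keep fresh)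
        in (fz , ι t) ∷ w ,
           fire eq i≡q (here (clamp-source i i≡q , refl , jmpTransition-enabled f (ι t) q t′ , run))

    Simulates-empty : Simulates emptyRegs (λ _ → 0)
    Simulates-empty r _ = encodes [] refl [] (λ e ()) (λ e ()) (λ e ()) (λ e ())

    toRSA-sound : ∀ {P start w} → WellFormed P → start < suc n' → Accepts 𝔻 (toRSA P start) w →
                  ReachesAccept P start (λ _ → 0)
    toRSA-sound {P} {start} {w} wf start< (q , q∈ , run) =
      subst (λ z → ReachesAccept P z (λ _ → 0))
            (trans (cong toℕ (x∈⁅y⁆⇒x≡y (clamp start) q∈)) (toℕ-clamp start start<))
            (run⇒ReachesAccept P wf w q emptyRegs (λ _ → 0) run Simulates-empty)

    toRSA-complete : ℕ ↣ 𝔻 → ∀ {P start} → WellFormed P → start < suc n' → ReachesAccept P start (λ _ → 0) →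
                     ¬ IsEmpty 𝔻 (toRSA P start)
    toRSA-complete inj {P} {start} wf start< (_ , steps) empty =
      let (w , run) = Completeness.Steps⇒run inj P wf steps (clamp start) emptyRegs 0 (toℕ-clamp start start<)
                                              Simulates-empty (λ _ _ ())
      in empty (w , clamp start , x∈⁅x⁆ (clamp start) , run)

-- μ-recursive programs computing the code of an automaton

record Computable (n : ℕ) (f : Vec ℕ n → ℕ) : Set where
  constructor cm
  field
    prg : PR n
    ok  : ∀ xs → Eval prg xs (f xs)
open Computable public

cast : ∀ {n f g} → Computable n f → (∀ xs → f xs ≡ g xs) → Computable n g
cast (cm p o) e = cm p (λ xs → subst (Eval p xs) (e xs) (o xs))

primRec : ∀ {n} → (Vec ℕ n → ℕ) → (Vec ℕ (suc (suc n)) → ℕ) → Vec ℕ (suc n) → ℕ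
primRec g h (zero ∷ xs) = g xs
primRec g h (suc x ∷ xs) = h (x ∷ primRec g h (x ∷ xs) ∷ xs)

prec-computable : ∀ {n g h} → Computable n g → Computable (suc (suc n)) h → Computable (suc n) (primRec g h)
prec-computable {n} {g} {h} (cm pg og) (cm ph oh) = cm (prec pg ph) correct
  where
  correct : ∀ xs → Eval (prec pg ph) xs (primRec g h xs)
  correct (zero ∷ xs) = e-prec0 (og xs)
  correct (suc x ∷ xs) = e-precS (correct (x ∷ xs)) (oh _)

constPR : ∀ {n} → ℕ → PR n
constPR zero = zer
constPR (suc k) = comp succ (constPR k ∷ [])

constPR-correct : ∀ {n} k (xs : Vec ℕ n) → Eval (constPR k) xs k
constPR-correct zero xs = e-zer
constPR-correct (suc k) xs = e-comp (ev-∷ (constPR-correct k xs) ev-[]) e-succ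

fromVec₁ : (ℕ → ℕ) → Vec ℕ 1 → ℕ
fromVec₁ f (x ∷ []) = f x
fromVec₂ : (ℕ → ℕ → ℕ) → Vec ℕ 2 → ℕ
fromVec₂ f (x ∷ y ∷ []) = f x y

succ-computable : Computable 1 (fromVec₁ suc)
succ-computable = cm succ (λ { (x ∷ []) → e-succ })

data Expr (n : ℕ) : Set where
  var : Fin n → Expr n
  lit : ℕ → Expr n
  app : ∀ {m} {f : Vec ℕ m → ℕ} → Computable m f → Vec (Expr n) m → Expr n

mutual
  ⟦_⟧ : ∀ {n} → Expr n → Vec ℕ n → ℕ
  ⟦ var i ⟧ xs = lookup xs i
  ⟦ lit k ⟧ xs = k
  ⟦ app {f = f} c es ⟧ xs = f (⟦ es ⟧* xs)

  ⟦_⟧* : ∀ {n m} → Vec (Expr n) m → Vec ℕ n → Vec ℕ m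
  ⟦ [] ⟧* xs = []
  ⟦ e ∷ es ⟧* xs = ⟦ e ⟧ xs ∷ ⟦ es ⟧* xs

mutual
  exprPR : ∀ {n} → Expr n → PR n
  exprPR (var i) = proj i
  exprPR (lit k) = constPR k
  exprPR (app c es) = comp (prg c) (exprPRs es)

  exprPRs : ∀ {n m} → Vec (Expr n) m → Vec (PR n) m
  exprPRs [] = []
  exprPRs (e ∷ es) = exprPR e ∷ exprPRs es

mutual
  exprPR-correct : ∀ {n} (e : Expr n) xs → Eval (exprPR e) xs (⟦ e ⟧ xs)
  exprPR-correct (var i) xs = e-proj
  exprPR-correct (lit k) xs = constPR-correct k xs
  exprPR-correct (app c es) xs = e-comp (exprPRs-correct es xs) (ok c _)

  exprPRs-correct : ∀ {n m} (es : Vec (Expr n) m) xs → EvalVec (exprPRs es) xs (⟦ es ⟧* xs)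
  exprPRs-correct [] xs = ev-[]
  exprPRs-correct (e ∷ es) xs = ev-∷ (exprPR-correct e xs) (exprPRs-correct es xs)

expr-computable : ∀ {n} (e : Expr n) → Computable n ⟦ e ⟧
expr-computable e = cm (exprPR e) (exprPR-correct e)

v₀ : ∀ {n} → Expr (suc n)
v₀ = var fz
v₁ : ∀ {n} → Expr (suc (suc n))
v₁ = var (fs fz)
v₂ : ∀ {n} → Expr (suc (suc (suc n)))
v₂ = var (fs (fs fz))
v₃ : ∀ {n} → Expr (suc (suc (suc (suc n))))
v₃ = var (fs (fs (fs fz)))

app₁ : ∀ {n f} → Computable 1 f → Expr n → Expr n
app₁ c x = app c (x ∷ [])
app₂ : ∀ {n f} → Computable 2 f → Expr n → Expr n → Expr n
app₂ c x y = app c (x ∷ y ∷ [])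

+-computable : Computable 2 (fromVec₂ _+_)
+-computable = cast (prec-computable (expr-computable v₀) (expr-computable (app₁ succ-computable v₁))) agrees
  where
  agrees : ∀ xs → primRec ⟦ v₀ ⟧ ⟦ app₁ succ-computable v₁ ⟧ xs ≡ fromVec₂ _+_ xs
  agrees (zero ∷ y ∷ []) = refl
  agrees (suc x ∷ y ∷ []) = cong suc (agrees (x ∷ y ∷ []))

tri-computable : Computable 1 (fromVec₁ tri)
tri-computable =
  cast (prec-computable (expr-computable (lit 0)) (expr-computable (app₂ +-computable (app₁ succ-computable v₀) v₁))) agrees
  where
  agrees : ∀ xs → primRec ⟦ lit 0 ⟧ ⟦ app₂ +-computable (app₁ succ-computable v₀) v₁ ⟧ xs ≡ fromVec₁ tri xs
  agrees (zero ∷ []) = refl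
  agrees (suc x ∷ []) = cong (suc x +_) (agrees (x ∷ []))

pair-computable : Computable 2 (fromVec₂ pair)
pair-computable = cast (expr-computable (app₂ +-computable (app₁ tri-computable (app₂ +-computable v₀ v₁)) v₁))
                       (λ { (x ∷ y ∷ []) → refl })

-- Opaque, as are the codes built from it below, to keep type checking from normalising huge numerals.
opaque
  cons : ℕ → ℕ → ℕ
  cons x y = suc (pair x y)

opaque
  unfolding cons
  cons-computable : Computable 2 (fromVec₂ cons)
  cons-computable = cast (expr-computable (app₁ succ-computable (app₂ pair-computable v₀ v₁)))
                         (λ { (x ∷ y ∷ []) → refl })

zerosCode : ℕ → ℕ
zerosCode zero = 0
zerosCode (suc z) = cons 0 (zerosCode z)

singletonCode : ℕ → ℕ → ℕ
singletonCode zero z = cons 1 (zerosCode z)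
singletonCode (suc r) z = cons 0 (singletonCode r z)

replicateCode : ℕ → ℕ → ℕ
replicateCode zero v = 0
replicateCode (suc l) v = cons v (replicateCode l v)

transitionCode : ℕ → ℕ → ℕ → ℕ → ℕ → ℕ → ℕ → ℕ → ℕ
transitionCode s a g1 g2 g3 g4 g5 t = cons s (cons a (cons g1 (cons g2 (cons g3 (cons g4 (cons g5 (cons t 0)))))))

incChainCode : ℕ → ℕ → ℕ → ℕ → ℕ → ℕ → ℕ → ℕ
incChainCode zero e s base zm k2 d = base
incChainCode (suc l) e s base zm k2 d =
  cons (transitionCode (s + l) 0 zm e k2 d e (suc (s + l))) (incChainCode l e s base zm k2 d)

-- The code of the diagonal automaton (Diagonal.code-A≡ψ) as a function of the numbers its machine
-- loads: a is the length of core, b0 + 4 the number of counters, c the code of the transitions of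
-- core and d that of keepAll.
ψ : ℕ → ℕ → ℕ → ℕ → ℕ
ψ a b0 c d =
  let M = b0 + 4
      m = M + M
      zm = zerosCode m
      k2 = replicateCode m zm
      L = a + b0 + c + d
      top = a + L
      s1 = a + a
      s2 = s1 + b0
      s3 = s2 + c
      Lc = cons (transitionCode top 0 zm zm k2 d zm 1)
             (incChainCode d (singletonCode 3 (b0 + b0 + 4)) s3
               (incChainCode c (singletonCode 2 (b0 + b0 + 5)) s2
                 (incChainCode b0 (singletonCode 1 (b0 + b0 + 6)) s1
                   (incChainCode a (singletonCode 0 (b0 + b0 + 7)) a c zm k2 d) zm k2 d) zm k2 d) zm k2 d)
  in cons (suc top) (cons m (cons Lc (cons (singletonCode a L) (cons (singletonCode 0 top) 0))))

consE : ∀ {n} → Expr n → Expr n → Expr n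
consE = app₂ cons-computable
addE : ∀ {n} → Expr n → Expr n → Expr n
addE = app₂ +-computable

zerosCode-computable : Computable 1 (fromVec₁ zerosCode)
zerosCode-computable = cast (prec-computable (expr-computable (lit 0)) (expr-computable (consE (lit 0) v₁))) agrees
  where
  agrees : ∀ xs → _ ≡ fromVec₁ zerosCode xs
  agrees (zero ∷ []) = refl
  agrees (suc x ∷ []) = cong (cons 0) (agrees (x ∷ []))

singletonCode-computable : Computable 2 (fromVec₂ singletonCode)
singletonCode-computable =
  cast (prec-computable (expr-computable (consE (lit 1) (app₁ zerosCode-computable v₀))) (expr-computable (consE (lit 0) v₁))) agrees
  where
  agrees : ∀ xs → _ ≡ fromVec₂ singletonCode xs
  agrees (zero ∷ z ∷ []) = refl
  agrees (suc x ∷ z ∷ []) = cong (cons 0) (agrees (x ∷ z ∷ []))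

replicateCode-computable : Computable 2 (fromVec₂ replicateCode)
replicateCode-computable = cast (prec-computable (expr-computable (lit 0)) (expr-computable (consE v₂ v₁))) agrees
  where
  agrees : ∀ xs → _ ≡ fromVec₂ replicateCode xs
  agrees (zero ∷ v ∷ []) = refl
  agrees (suc x ∷ v ∷ []) = cong (cons v) (agrees (x ∷ v ∷ []))

transitionCodeE : ∀ {n} → Expr n → Expr n → Expr n → Expr n → Expr n → Expr n → Expr n → Expr n → Expr n
transitionCodeE s a g1 g2 g3 g4 g5 t = consE s (consE a (consE g1 (consE g2 (consE g3 (consE g4 (consE g5 (consE t (lit 0))))))))

fromVec₇ : (ℕ → ℕ → ℕ → ℕ → ℕ → ℕ → ℕ → ℕ) → Vec ℕ 7 → ℕ
fromVec₇ f (l ∷ e ∷ s ∷ base ∷ zm ∷ k2 ∷ d ∷ []) = f l e s base zm k2 d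

incChainCode-computable : Computable 7 (fromVec₇ incChainCode)
incChainCode-computable =
  cast (prec-computable (expr-computable (var (# 2)))
         (expr-computable (consE (transitionCodeE (addE (var (# 3)) (var (# 0))) (lit 0) (var (# 5)) (var (# 2))
                                                  (var (# 6)) (var (# 7)) (var (# 2))
                                                  (app₁ succ-computable (addE (var (# 3)) (var (# 0)))))
                                 (var (# 1))))) agrees
  where
  agrees : ∀ xs → _ ≡ fromVec₇ incChainCode xs
  agrees (zero ∷ e ∷ s ∷ base ∷ zm ∷ k2 ∷ d ∷ []) = refl
  agrees (suc l ∷ e ∷ s ∷ base ∷ zm ∷ k2 ∷ d ∷ []) =
    cong (cons (transitionCode (s + l) 0 zm e k2 d e (suc (s + l)))) (agrees (l ∷ e ∷ s ∷ base ∷ zm ∷ k2 ∷ d ∷ []))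

incChainCodeE : ∀ {n} → Expr n → Expr n → Expr n → Expr n → Expr n → Expr n → Expr n → Expr n
incChainCodeE l e s base zm k2 d = app incChainCode-computable (l ∷ e ∷ s ∷ base ∷ zm ∷ k2 ∷ d ∷ [])

fromVec₄ : (ℕ → ℕ → ℕ → ℕ → ℕ) → Vec ℕ 4 → ℕ
fromVec₄ f (a ∷ b ∷ c ∷ d ∷ []) = f a b c d

ψE : Expr 4
ψE =
  let a = v₀; b0 = v₁; c = v₂; d = v₃
      M = addE b0 (lit 4)
      m = addE M M
      zm = app₁ zerosCode-computable m
      k2 = app₂ replicateCode-computable m zm
      L = addE (addE (addE a b0) c) d
      top = addE a L
      s1 = addE a a
      s2 = addE s1 b0
      s3 = addE s2 c
      bb = addE b0 b0
      Lc = consE (transitionCodeE top (lit 0) zm zm k2 d zm (lit 1))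
             (incChainCodeE d (app₂ singletonCode-computable (lit 3) (addE bb (lit 4))) s3
               (incChainCodeE c (app₂ singletonCode-computable (lit 2) (addE bb (lit 5))) s2
                 (incChainCodeE b0 (app₂ singletonCode-computable (lit 1) (addE bb (lit 6))) s1
                   (incChainCodeE a (app₂ singletonCode-computable (lit 0) (addE bb (lit 7))) a c zm k2 d) zm k2 d) zm k2 d) zm k2 d)
  in consE (app₁ succ-computable top) (consE m (consE Lc (consE (app₂ singletonCode-computable a L)
       (consE (app₂ singletonCode-computable (lit 0) top) (lit 0)))))

ψ-computable : Computable 4 (fromVec₄ ψ)
ψ-computable = cast (expr-computable ψE) (λ { (a ∷ b ∷ c ∷ d ∷ []) → refl })

-- Codes of automata

encTransitions-++ : ∀ {k n m} (xs ys : List (Transition k n m)) → encTransitions (xs ++ ys) ≡ encTransitions xs ++ encTransitions ys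
encTransitions-++ [] ys = refl
encTransitions-++ (x ∷ xs) ys = cong (encTransition x ∷_) (encTransitions-++ xs ys)

opaque
  unfolding cons
  encList-cons : ∀ x xs → encList (x ∷ xs) ≡ cons x (encList xs)
  encList-cons x xs = refl

encSubset-∅ : ∀ m → encSubset (∅ {m}) ≡ zerosCode m
encSubset-∅ zero = refl
encSubset-∅ (suc m) = trans (encList-cons 0 _) (cong (cons 0) (encSubset-∅ m))

encSubset-⁅⁆ : ∀ {N} (i : Fin N) → encSubset ⁅ i ⁆ ≡ singletonCode (toℕ i) (N ∸ suc (toℕ i))
encSubset-⁅⁆ {suc N} fz = trans (encList-cons 1 _) (cong (cons 1) (encSubset-∅ N))
encSubset-⁅⁆ {suc N} (fs i) = trans (encList-cons 0 _) (cong (cons 0) (encSubset-⁅⁆ i))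

encSubsets-replicate : ∀ {m} l (v : Subset m) → encList (encSubsets (replicate l v)) ≡ replicateCode l (encSubset v)
encSubsets-replicate zero v = refl
encSubsets-replicate (suc l) v = trans (encList-cons _ _) (cong (cons (encSubset v)) (encSubsets-replicate l v))

toℕ-clamp-indep : ∀ {n₁ n₂} x → x < suc n₁ → x < suc n₂ → toℕ (clamp {n₁} x) ≡ toℕ (clamp {n₂} x)
toℕ-clamp-indep x l1 l2 = trans (toℕ-clamp x l1) (sym (toℕ-clamp x l2))

encTransition-cong : ∀ {k n₁ n₂ m} (s₁ : Fin n₁) (s₂ : Fin n₂) (t₁ : Fin n₁) (t₂ : Fin n₂) (a : Fin (suc k))
                       (gi gn : Subset m) (ge ur : Vec (Subset m) m) (ui : Subset m) →
                     toℕ s₁ ≡ toℕ s₂ → toℕ t₁ ≡ toℕ t₂ →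
                     encTransition (mkTransition s₁ a gi gn ge ur ui t₁) ≡ encTransition (mkTransition s₂ a gi gn ge ur ui t₂)
encTransition-cong s₁ s₂ t₁ t₂ a gi gn ge ur ui s≡ t≡ =
  cong₂ (λ x y → encList (x ∷ toℕ a ∷ encSubset gi ∷ encSubset gn ∷ encList (encSubsets ge) ∷
                          encList (encSubsets ur) ∷ encSubset ui ∷ y ∷ [])) s≡ t≡

encTransitions-indep : ∀ k M' n₁ n₂ s ins → s < suc n₁ → s < suc n₂ →
                       Bounded (suc M') (suc n₁) ins → Bounded (suc M') (suc n₂) ins →
                       encTransitions (CounterRSA.instrTransitions k n₁ M' s ins) ≡
                       encTransitions (CounterRSA.instrTransitions k n₂ M' s ins)
encTransitions-indep k M' n₁ n₂ s (inc r t) s<₁ s<₂ (_ , t<₁) (_ , t<₂) =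
  cong (_∷ []) (encTransition-cong (clamp {n₁} s) (clamp {n₂} s) (clamp {n₁} t) (clamp {n₂} t) (fz {k})
                  (∅ {R.m}) ⁅ R.X r ⁆ R.noEqTest R.keepAll ⁅ R.X r ⁆
                  (toℕ-clamp-indep s s<₁ s<₂) (toℕ-clamp-indep t t<₁ t<₂))
  where module R = Registers M'
encTransitions-indep k M' n₁ n₂ s (decjz r t₁ t₀) s<₁ s<₂ (_ , t₁<₁ , t₀<₁) (_ , t₁<₂ , t₀<₂) =
  cong₂ _∷_ (encTransition-cong (clamp {n₁} s) (clamp {n₂} s) (clamp {n₁} t₁) (clamp {n₂} t₁) (fz {k})
               ⁅ R.X r ⁆ ⁅ R.Y r ⁆ R.noEqTest R.keepAll ⁅ R.Y r ⁆
               (toℕ-clamp-indep s s<₁ s<₂) (toℕ-clamp-indep t₁ t₁<₁ t₁<₂))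
            (cong (_∷ []) (encTransition-cong (clamp {n₁} s) (clamp {n₂} s) (clamp {n₁} t₀) (clamp {n₂} t₀) (fz {k})
               (∅ {R.m}) (∅ {R.m}) (R.eqTest r) R.keepAll (∅ {R.m})
               (toℕ-clamp-indep s s<₁ s<₂) (toℕ-clamp-indep t₀ t₀<₁ t₀<₂)))
  where module R = Registers M'
encTransitions-indep k M' n₁ n₂ s (jmp t) s<₁ s<₂ t<₁ t<₂ =
  cong (_∷ []) (encTransition-cong (clamp {n₁} s) (clamp {n₂} s) (clamp {n₁} t) (clamp {n₂} t) (fz {k})
                  (∅ {R.m}) (∅ {R.m}) R.noEqTest R.keepAll (∅ {R.m})
                  (toℕ-clamp-indep s s<₁ s<₂) (toℕ-clamp-indep t t<₁ t<₂))
  where module R = Registers M'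
encTransitions-indep k M' n₁ n₂ s acc _ _ _ _ = refl
encTransitions-indep k M' n₁ n₂ s rej _ _ _ _ = refl

opaque
  list₈Code : ℕ → ℕ → ℕ → ℕ → ℕ → ℕ → ℕ → ℕ → ℕ
  list₈Code x1 x2 x3 x4 x5 x6 x7 x8 = encList (x1 ∷ x2 ∷ x3 ∷ x4 ∷ x5 ∷ x6 ∷ x7 ∷ x8 ∷ [])

opaque
  unfolding list₈Code cons
  encTransition≡list₈ : ∀ {k n m} (s : Fin n) (a' : Fin (suc k)) (gi gn : Subset m) (ge ur : Vec (Subset m) m) (ui : Subset m) (t : Fin n) →
          encTransition (mkTransition s a' gi gn ge ur ui t) ≡
          list₈Code (toℕ s) (toℕ a') (encSubset gi) (encSubset gn) (encList (encSubsets ge)) (encList (encSubsets ur)) (encSubset ui) (toℕ t)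
  encTransition≡list₈ s a' gi gn ge ur ui t = refl

  transitionCode≡list₈ : ∀ x1 x2 x3 x4 x5 x6 x7 x8 → transitionCode x1 x2 x3 x4 x5 x6 x7 x8 ≡ list₈Code x1 x2 x3 x4 x5 x6 x7 x8
  transitionCode≡list₈ x1 x2 x3 x4 x5 x6 x7 x8 = refl

opaque
  list₅Code : ℕ → ℕ → ℕ → ℕ → ℕ → ℕ
  list₅Code x1 x2 x3 x4 x5 = encList (x1 ∷ x2 ∷ x3 ∷ x4 ∷ x5 ∷ [])

codeOfTransitions : ℕ → ℕ → ℕ → ℕ → ℕ → ℕ → ℕ → ℕ → ℕ → ℕ → ℕ → ℕ → ℕ → ℕ → ℕ → ℕ
codeOfTransitions top a b0 c d s1 s2 s3 zm k2 e0 e1 e2 e3 one =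
  cons (transitionCode top 0 zm zm k2 d zm one)
   (incChainCode d e3 s3 (incChainCode c e2 s2 (incChainCode b0 e1 s1 (incChainCode a e0 a c zm k2 d) zm k2 d) zm k2 d) zm k2 d)

opaque
  unfolding list₅Code cons
  cons⁵≡list₅ : ∀ x1 x2 x3 x4 x5 → cons x1 (cons x2 (cons x3 (cons x4 (cons x5 0)))) ≡ list₅Code x1 x2 x3 x4 x5
  cons⁵≡list₅ x1 x2 x3 x4 x5 = refl

  code≡list₅ : ∀ {k} n m Δ I F → code {k} (mkRSA n m Δ I F) ≡ list₅Code n m (encList (encTransitions Δ)) (encSubset I) (encSubset F)
  code≡list₅ n m Δ I F = refl

ψ≡list₅ : ∀ a b0 c d → ψ a b0 c d ≡
     list₅Code (suc (a + (a + b0 + c + d))) ((b0 + 4) + (b0 + 4))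
       (codeOfTransitions (a + (a + b0 + c + d)) a b0 c d (a + a) (a + a + b0) (a + a + b0 + c)
            (zerosCode ((b0 + 4) + (b0 + 4))) (replicateCode ((b0 + 4) + (b0 + 4)) (zerosCode ((b0 + 4) + (b0 + 4))))
            (singletonCode 0 (b0 + b0 + 7)) (singletonCode 1 (b0 + b0 + 6)) (singletonCode 2 (b0 + b0 + 5)) (singletonCode 3 (b0 + b0 + 4)) 1)
       (singletonCode a (a + b0 + c + d)) (singletonCode 0 (a + (a + b0 + c + d)))
ψ≡list₅ a b0 c d = cons⁵≡list₅ (suc (a + (a + b0 + c + d))) ((b0 + 4) + (b0 + 4))
         (codeOfTransitions (a + (a + b0 + c + d)) a b0 c d (a + a) (a + a + b0) (a + a + b0 + c)
              (zerosCode ((b0 + 4) + (b0 + 4))) (replicateCode ((b0 + 4) + (b0 + 4)) (zerosCode ((b0 + 4) + (b0 + 4))))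
              (singletonCode 0 (b0 + b0 + 7)) (singletonCode 1 (b0 + b0 + 6)) (singletonCode 2 (b0 + b0 + 5)) (singletonCode 3 (b0 + b0 + 4)) 1)
         (singletonCode a (a + b0 + c + d)) (singletonCode 0 (a + (a + b0 + c + d)))

cong6 : ∀ {A B C D E F G : Set} (f : A → B → C → D → E → F → G) {a a' b b' c c' d d' e e' x x'} →
        a ≡ a' → b ≡ b' → c ≡ c' → d ≡ d' → e ≡ e' → x ≡ x' → f a b c d e x ≡ f a' b' c' d' e' x'
cong6 f refl refl refl refl refl refl = refl

cong5 : ∀ {A B C D E G : Set} (f : A → B → C → D → E → G) {a a' b b' c c' d d' e e'} →
        a ≡ a' → b ≡ b' → c ≡ c' → d ≡ d' → e ≡ e' → f a b c d e ≡ f a' b' c' d' e'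
cong5 f refl refl refl refl refl = refl

+-∸-cancel : ∀ x j k → (x + (j + k)) ∸ j ≡ x + k
+-∸-cancel x j k = trans (cong (_∸ j) (trans (cong (x +_) (+-comm j k)) (sym (+-assoc x k j)))) (m+n∸n≡m (x + k) j)

-- The diagonal counter machine

maxReg : Cmd → ℕ
maxReg skip = 0
maxReg (incC r) = r
maxReg (c₁ ⨾ c₂) = maxReg c₁ ⊔ maxReg c₂
maxReg (loop r c) = r ⊔ maxReg c

Bounded-mono : ∀ {M M′ N N′} → M ≤ M′ → N ≤ N′ → ∀ {i} → Bounded M N i → Bounded M′ N′ i
Bounded-mono M≤ N≤ {inc r t} (r< , t<) = <-≤-trans r< M≤ , <-≤-trans t< N≤
Bounded-mono M≤ N≤ {decjz r t₁ t₀} (r< , t₁< , t₀<) = <-≤-trans r< M≤ , <-≤-trans t₁< N≤ , <-≤-trans t₀< N≤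
Bounded-mono M≤ N≤ {jmp t} t< = <-≤-trans t< N≤
Bounded-mono M≤ N≤ {acc} _ = tt
Bounded-mono M≤ N≤ {rej} _ = tt

flatten-bounded : ∀ c o → LAll (Bounded (suc (maxReg c)) (suc (o + size c))) (flatten c o)
flatten-bounded skip o = a[]
flatten-bounded (incC r) o = (≤-refl , s≤s (≤-reflexive (+-comm 1 o))) a∷ a[]
flatten-bounded (c₁ ⨾ c₂) o =
  ++⁺ (LAll.map (Bounded-mono (s≤s (m≤m⊔n _ _)) (s≤s (+-monoʳ-≤ o (m≤m+n _ _)))) (flatten-bounded c₁ o))
      (LAll.map (Bounded-mono (s≤s (m≤n⊔m _ _)) (s≤s (≤-reflexive (+-assoc o (size c₁) (size c₂)))))
                (flatten-bounded c₂ (o + size c₁)))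
flatten-bounded (loop r c) o =
  (s≤s (m≤m⊔n r _) , s≤s (≤-trans (s≤s (m≤m+n o _)) (≤-reflexive (sym (+-suc o (suc (size c)))))) , ≤-refl) a∷
  ++⁺ (LAll.map (Bounded-mono (s≤s (m≤n⊔m r _))
                              (s≤s (≤-trans (≤-reflexive (sym (+-suc o (size c)))) (+-monoʳ-≤ o (n≤1+n _)))))
                (flatten-bounded c (suc o)))
      (s≤s (m≤m+n o _) a∷ a[])

fetch-all : ∀ {Q : Instr → Set} {L} → LAll Q L → Q rej → ∀ s → Q (fetch L s)
fetch-all a[] q-rej s = q-rej
fetch-all (q a∷ qs) q-rej zero = q
fetch-all (q a∷ qs) q-rej (suc s) = fetch-all qs q-rej s

incChain : ℕ → ℕ → ℕ → List Instr
incChain r zero s = []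
incChain r (suc l) s = inc r (suc s) ∷ incChain r l (suc s)

length-incChain : ∀ r l s → length (incChain r l s) ≡ l
length-incChain r zero s = refl
length-incChain r (suc l) s = cong suc (length-incChain r l (suc s))

fetch-incChain : ∀ r l s rest j → j < l → fetch (incChain r l s ++ rest) j ≡ inc r (suc (s + j))
fetch-incChain r (suc l) s rest zero _ rewrite +-identityʳ s = refl
fetch-incChain r (suc l) s rest (suc j) (s≤s lt) rewrite +-suc s j = fetch-incChain r l (suc s) rest j lt

Suffix : List Instr → ℕ → List Instr → Set
Suffix P s₀ L = ∀ j → fetch P (s₀ + j) ≡ fetch L j

incChain-fetch : ∀ {P s r l rest} → Suffix P s (incChain r l s ++ rest) → ∀ j → j < l → fetch P (s + j) ≡ inc r (suc (s + j))
incChain-fetch {P} {s} {r} {l} {rest} sf j lt = trans (sf j) (fetch-incChain r l s rest j lt)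

incChain-Suffix : ∀ {P s r l rest} → Suffix P s (incChain r l s ++ rest) → Suffix P (s + l) rest
incChain-Suffix {P} {s} {r} {l} {rest} sf j =
  trans (cong (fetch P) (+-assoc s l j))
   (trans (sf (l + j)) (trans (cong (λ z → fetch (incChain r l s ++ rest) (z + j)) (sym (length-incChain r l s)))
                              (fetch-++ʳ (incChain r l s) rest j)))

incChain-bounded : ∀ {M N} r l s → r < M → s + l < N → LAll (Bounded M N) (incChain r l s)
incChain-bounded r zero s rm lt = a[]
incChain-bounded {M} {N} r (suc l) s r<M s+l<N =
  (r<M , ≤-<-trans (≤-trans (s≤s (m≤m+n s l)) (≤-reflexive (sym (+-suc s l)))) s+l<N) a∷
  incChain-bounded r l (suc s) r<M (subst (_< N) (+-suc s l) s+l<N)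

incChain-Steps : ∀ {P s r l rest} → Suffix P s (incChain r l s ++ rest) → ∀ σ →
            Σ Env λ σ' → Steps P s σ (s + l) σ' × (σ' r ≡ σ r + l) × AgreeExcept σ σ' r
incChain-Steps {P} {s} {r} {zero} sf σ rewrite +-identityʳ s = σ , done , sym (+-identityʳ _) , λ _ _ → refl
incChain-Steps {P} {s} {r} {suc l} {rest} sf σ
  with incChain-Steps {P} {suc s} {r} {l} {rest} (λ j → trans (cong (fetch P) (sym (+-suc s j))) (sf (suc j)))
                     (assign σ r (suc (σ r)))
... | σ' , st , v , sm =
  σ' , more (s-inc (subst (λ z → fetch P z ≡ inc r (suc s)) (+-identityʳ s) (trans (sf 0) refl)))
             (subst (λ z → Steps P (suc s) (assign σ r (suc (σ r))) z σ') (sym (+-suc s l)) st) ,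
  trans v (trans (cong (_+ l) (assign-≡ σ r _)) (sym (+-suc _ l))) ,
  λ j ne → trans (sm j ne) (assign-≢ σ r _ j ne)

module Diagonal (k : ℕ) (p : PR 1) where
  opaque
    ψPR : PR 4
    ψPR = prg ψ-computable

    ψPR-correct : ∀ xs → Eval ψPR xs (fromVec₄ ψ xs)
    ψPR-correct = ok ψ-computable

  -- main computes p (ψ r₀ r₁ r₂ r₃) into register 5, and decide accepts iff that value is 1.
  main : Cmd
  main = compilePR ψPR (0 ∷ 1 ∷ 2 ∷ 3 ∷ []) 4 6 ⨾ compilePR p (4 ∷ []) 5 6

  mainSize : ℕ
  mainSize = size main

  decide : List Instr
  decide = decjz 5 (2 + mainSize) (3 + mainSize) ∷ decjz 5 (3 + mainSize) 0 ∷ rej ∷ []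

  core : List Instr
  core = acc ∷ (flatten main 1 ++ decide)

  a : ℕ
  a = length core

  -- The automaton has counters 0, …, b0 + 3, enough for all those used by main.
  b0 : ℕ
  b0 = maxReg main + 2

  M' : ℕ
  M' = b0 + 3

  module CoreRSA = CounterRSA k a M'

  -- The transitions of core do not depend on the number of states (encTransitions-indep),
  -- so c is also the code of the transitions of A at the addresses below a.
  c : ℕ
  c = encList (encTransitions (CoreRSA.transitionsOf core (downFrom a)))

  d : ℕ
  d = encList (encSubsets (Registers.keepAll M'))

  L : ℕ
  L = a + b0 + c + d

  top : ℕ
  top = a + L

  -- Started at address a, the machine loads a, b0, c, d into the counters 0 to 3 and jumps to main.
  loader loader₁ loader₂ loader₃ loader₄ : List Instr
  loader = incChain 0 a a ++ loader₁
  loader₁ = incChain 1 b0 (a + a) ++ loader₂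
  loader₂ = incChain 2 c (a + a + b0) ++ loader₃
  loader₃ = incChain 3 d (a + a + b0 + c) ++ loader₄
  loader₄ = jmp 1 ∷ []

  P : List Instr
  P = core ++ loader

  module FullRSA = CounterRSA k top M'

  A : RSA k
  A = FullRSA.toRSA P a

  a≡ : a ≡ suc (mainSize + 3)
  a≡ = cong suc (trans (length-++ (flatten main 1)) (cong (_+ 3) (length-flatten main 1)))

  suffix₀ : Suffix P a loader
  suffix₀ j = fetch-++ʳ core loader j
  suffix₁ : Suffix P (a + a) loader₁
  suffix₁ = incChain-Suffix {P} {a} {0} {a} suffix₀
  suffix₂ : Suffix P (a + a + b0) loader₂
  suffix₂ = incChain-Suffix {P} {a + a} {1} {b0} suffix₁
  suffix₃ : Suffix P (a + a + b0 + c) loader₃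
  suffix₃ = incChain-Suffix {P} {a + a + b0} {2} {c} suffix₂
  suffix₄ : Suffix P (a + a + b0 + c + d) loader₄
  suffix₄ = incChain-Suffix {P} {a + a + b0 + c} {3} {d} suffix₃

  top≡ : top ≡ a + a + b0 + c + d
  top≡ = sym (trans (cong (_+ d) (cong (_+ c) (+-assoc a a b0)))
              (trans (cong (_+ d) (+-assoc a (a + b0) c)) (+-assoc a (a + b0 + c) d)))

  fetch-top : fetch P top ≡ jmp 1
  fetch-top = trans (cong (fetch P) (trans top≡ (sym (+-identityʳ _)))) (suffix₄ 0)

  fetch-core : ∀ s → s < a → fetch P s ≡ fetch core s
  fetch-core s lt = fetch-++ˡ core loader s lt

  M : ℕ
  M = suc M'

  maxReg<M : maxReg main ⊔ 5 < M
  maxReg<M = s≤s (⊔-lub (≤-trans (m≤m+n _ 2) (m≤m+n _ 3)) (+-monoˡ-≤ 3 (m≤n+m 2 (maxReg main))))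

  decide<a : 3 + mainSize < a
  decide<a = subst (3 + mainSize <_) (sym a≡) (s≤s (≤-reflexive (+-comm 3 mainSize)))

  core-bounded′ : LAll (Bounded (suc (maxReg main ⊔ 5)) (suc (3 + mainSize))) core
  core-bounded′ = tt a∷ ++⁺ (LAll.map (Bounded-mono (s≤s (m≤m⊔n _ _)) (s≤s (m≤n+m (1 + mainSize) 2))) (flatten-bounded main 1))
                        ((s≤s (m≤n⊔m _ 5) , s≤s (n≤1+n (2 + mainSize)) , ≤-refl) a∷
                         (s≤s (m≤n⊔m _ 5) , ≤-refl , s≤s z≤n) a∷ tt a∷ a[])

  core-bounded : LAll (Bounded M a) core
  core-bounded = LAll.map (Bounded-mono maxReg<M decide<a) core-bounded′

  a≤top : a ≤ top
  a≤top = m≤m+n a L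

  loader₁≤top : a + a ≤ top
  loader₁≤top = subst (a + a ≤_) (sym top≡) (≤-trans (m≤m+n _ b0) (≤-trans (m≤m+n _ c) (m≤m+n _ d)))
  loader₂≤top : a + a + b0 ≤ top
  loader₂≤top = subst (a + a + b0 ≤_) (sym top≡) (≤-trans (m≤m+n _ c) (m≤m+n _ d))
  loader₃≤top : a + a + b0 + c ≤ top
  loader₃≤top = subst (a + a + b0 + c ≤_) (sym top≡) (m≤m+n _ d)
  loader₄≤top : a + a + b0 + c + d ≤ top
  loader₄≤top = ≤-reflexive (sym top≡)

  0<a : 0 < a
  0<a = subst (0 <_) (sym a≡) (s≤s z≤n)

  r<M : ∀ {r} → r ≤ 5 → r < M
  r<M le = ≤-<-trans (≤-trans le (m≤n⊔m _ 5)) maxReg<M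

  loader-bounded : LAll (Bounded M (suc top)) loader
  loader-bounded = ++⁺ (incChain-bounded 0 a a (r<M z≤n) (s≤s loader₁≤top))
            (++⁺ (incChain-bounded 1 b0 (a + a) (r<M (s≤s z≤n)) (s≤s loader₂≤top))
            (++⁺ (incChain-bounded 2 c (a + a + b0) (r<M (s≤s (s≤s z≤n))) (s≤s loader₃≤top))
            (++⁺ (incChain-bounded 3 d (a + a + b0 + c) (r<M (s≤s (s≤s (s≤s z≤n)))) (s≤s loader₄≤top))
                 (s≤s (≤-trans 0<a a≤top) a∷ a[]))))

  P-bounded : LAll (Bounded M (suc top)) P
  P-bounded = ++⁺ (LAll.map (Bounded-mono ≤-refl (≤-trans a≤top (n≤1+n top))) core-bounded) loader-bounded

  P-wellFormed : ∀ s → s < suc top → Bounded M (suc top) (fetch P s)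
  P-wellFormed s _ = fetch-all P-bounded tt s

  core-bounded-at : ∀ s → Bounded M a (fetch core s)
  core-bounded-at s = fetch-all core-bounded tt s

  encTransitions-core : ∀ ss → LAll (_< a) ss → encTransitions (FullRSA.transitionsOf P ss) ≡ encTransitions (CoreRSA.transitionsOf core ss)
  encTransitions-core [] _ = refl
  encTransitions-core (s ∷ ss) (lt a∷ lts) =
    trans (encTransitions-++ (FullRSA.instrTransitions s (fetch P s)) (FullRSA.transitionsOf P ss))
     (trans (cong₂ _++_
        (trans (cong (λ i → encTransitions (FullRSA.instrTransitions s i)) (fetch-core s lt))
               (encTransitions-indep k M' top a s (fetch core s) (≤-trans lt (≤-trans a≤top (n≤1+n top))) (m≤n⇒m≤1+n lt)
                  (Bounded-mono ≤-refl (≤-trans a≤top (n≤1+n top)) (core-bounded-at s))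
                  (Bounded-mono ≤-refl (n≤1+n a) (core-bounded-at s))))
        (encTransitions-core ss lts))
      (sym (encTransitions-++ (CoreRSA.instrTransitions s (fetch core s)) (CoreRSA.transitionsOf core ss))))

  transitionsCode : List ℕ → ℕ
  transitionsCode ss = encList (encTransitions (FullRSA.transitionsOf P ss))

  core-code : transitionsCode (downFrom a) ≡ c
  core-code = cong encList (encTransitions-core (downFrom a) (applyDownFrom⁺₁ id a id))

  ∅code noEqCode : ℕ
  ∅code = encSubset (∅ {Registers.m M'})
  noEqCode = encList (encSubsets (Registers.noEqTest M'))
  Xcode : ℕ → ℕ
  Xcode r = encSubset ⁅ Registers.X M' r ⁆

  transitionsCode-inc : ∀ {x ss r t} → fetch P x ≡ inc r t →
    transitionsCode (x ∷ ss) ≡ cons (encTransition (FullRSA.incTransition x r t)) (transitionsCode ss)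
  transitionsCode-inc {x} {ss} eq =
    trans (cong (λ i → encList (encTransitions (FullRSA.instrTransitions x i ++ FullRSA.transitionsOf P ss))) eq)
          (encList-cons _ _)

  transitionsCode-jmp : ∀ {x ss t} → fetch P x ≡ jmp t →
    transitionsCode (x ∷ ss) ≡ cons (encTransition (FullRSA.jmpTransition x t)) (transitionsCode ss)
  transitionsCode-jmp {x} {ss} eq =
    trans (cong (λ i → encList (encTransitions (FullRSA.instrTransitions x i ++ FullRSA.transitionsOf P ss))) eq)
          (encList-cons _ _)

  encTransition-inc : ∀ x t r → x < suc top → t < suc top →
    encTransition (FullRSA.incTransition x r t) ≡ transitionCode x 0 ∅code (Xcode r) noEqCode d (Xcode r) t
  encTransition-inc x t r x< t< =
    trans (encTransition≡list₈ (clamp {top} x) (fz {k}) ∅ X (Registers.noEqTest M') (Registers.keepAll M') X (clamp t))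
     (trans (cong₂ (λ u v → list₈Code u 0 ∅code (Xcode r) noEqCode d (Xcode r) v) (toℕ-clamp {top} x x<) (toℕ-clamp {top} t t<))
            (sym (transitionCode≡list₈ x 0 ∅code (Xcode r) noEqCode d (Xcode r) t)))
    where X = ⁅ Registers.X M' r ⁆

  encTransition-jmp : ∀ x t → x < suc top → t < suc top →
    encTransition (FullRSA.jmpTransition x t) ≡ transitionCode x 0 ∅code ∅code noEqCode d ∅code t
  encTransition-jmp x t x< t< =
    trans (encTransition≡list₈ (clamp {top} x) (fz {k}) ∅ ∅ (Registers.noEqTest M') (Registers.keepAll M') ∅ (clamp t))
     (trans (cong₂ (λ u v → list₈Code u 0 ∅code ∅code noEqCode d ∅code v) (toℕ-clamp {top} x x<) (toℕ-clamp {top} t t<))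
            (sym (transitionCode≡list₈ x 0 ∅code ∅code noEqCode d ∅code t)))

  incChain-code : ∀ {s r} l → (∀ j → j < l → fetch P (s + j) ≡ inc r (suc (s + j))) → s + l ≤ top →
             transitionsCode (downFrom (s + l)) ≡ incChainCode l (Xcode r) s (transitionsCode (downFrom s)) ∅code noEqCode d
  incChain-code {s} {r} zero h le = cong (λ z → transitionsCode (downFrom z)) (+-identityʳ s)
  incChain-code {s} {r} (suc l) h le =
    trans (cong (λ z → transitionsCode (downFrom z)) (+-suc s l))
    (trans (transitionsCode-inc {s + l} {downFrom (s + l)} (h l (n<1+n l)))
    (cong₂ cons (encTransition-inc (s + l) (suc (s + l)) r lt1 lt2)
                (incChain-code {s} {r} l (λ j jl → h j (m≤n⇒m≤1+n jl)) (≤-trans (+-monoʳ-≤ s (n≤1+n l)) le))))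
    where
    le' : suc (s + l) ≤ top
    le' = subst (_≤ top) (+-suc s l) le
    lt1 : s + l < suc top
    lt1 = ≤-trans (n≤1+n _) (s≤s le')
    lt2 : suc (s + l) < suc top
    lt2 = s≤s le'

  s1 s2 s3 : ℕ
  s1 = a + a
  s2 = a + a + b0
  s3 = a + a + b0 + c

  chainCode : ℕ → ℕ → ℕ → ℕ → ℕ
  chainCode l r s base = incChainCode l (Xcode r) s base ∅code noEqCode d

  jmpCode : ℕ
  jmpCode = transitionCode top 0 ∅code ∅code noEqCode d ∅code 1

  transitionsCode-P : transitionsCode (downFrom (suc top)) ≡
                      cons jmpCode (chainCode d 3 s3 (chainCode c 2 s2 (chainCode b0 1 s1 (chainCode a 0 a c))))
  transitionsCode-P = begin
    transitionsCode (downFrom (suc top))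
      ≡⟨ transitionsCode-jmp {top} {downFrom top} fetch-top ⟩
    cons _ (transitionsCode (downFrom top))
      ≡⟨ cong₂ cons (encTransition-jmp top 1 ≤-refl (s≤s (≤-trans 0<a a≤top)))
                    (cong (λ z → transitionsCode (downFrom z)) top≡) ⟩
    cons jmpCode (transitionsCode (downFrom (s3 + d)))
      ≡⟨ cong (cons jmpCode) (incChain-code d (incChain-fetch {P} {s3} {3} {d} {loader₄} suffix₃) loader₄≤top) ⟩
    cons jmpCode (chainCode d 3 s3 (transitionsCode (downFrom (s2 + c))))
      ≡⟨ cong (λ z → cons jmpCode (chainCode d 3 s3 z))
              (incChain-code c (incChain-fetch {P} {s2} {2} {c} suffix₂) loader₃≤top) ⟩
    cons jmpCode (chainCode d 3 s3 (chainCode c 2 s2 (transitionsCode (downFrom (s1 + b0)))))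
      ≡⟨ cong (λ z → cons jmpCode (chainCode d 3 s3 (chainCode c 2 s2 z)))
              (incChain-code b0 (incChain-fetch {P} {s1} {1} {b0} suffix₁) loader₂≤top) ⟩
    cons jmpCode (chainCode d 3 s3 (chainCode c 2 s2 (chainCode b0 1 s1 (transitionsCode (downFrom (a + a))))))
      ≡⟨ cong (λ z → cons jmpCode (chainCode d 3 s3 (chainCode c 2 s2 (chainCode b0 1 s1 z))))
              (incChain-code a (incChain-fetch {P} {a} {0} {a} suffix₀) loader₁≤top) ⟩
    cons jmpCode (chainCode d 3 s3 (chainCode c 2 s2 (chainCode b0 1 s1 (chainCode a 0 a (transitionsCode (downFrom a))))))
      ≡⟨ cong (λ z → cons jmpCode (chainCode d 3 s3 (chainCode c 2 s2 (chainCode b0 1 s1 (chainCode a 0 a z))))) core-code ⟩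
    cons jmpCode (chainCode d 3 s3 (chainCode c 2 s2 (chainCode b0 1 s1 (chainCode a 0 a c))))
      ∎
    where open ≡-Reasoning

  mψ : ℕ
  mψ = (b0 + 4) + (b0 + 4)

  m≡mψ : Registers.m M' ≡ mψ
  m≡mψ = cong₂ _+_ (sym (+-suc b0 3)) (sym (+-suc b0 3))

  m≡2b0+8 : Registers.m M' ≡ (b0 + b0) + 8
  m≡2b0+8 = solve 1 (λ b → (con 1 :+ (b :+ con 3)) :+ (con 1 :+ (b :+ con 3)) := (b :+ b) :+ con 8) refl b0
    where open +-*-Solver

  ∅code≡ : ∅code ≡ zerosCode mψ
  ∅code≡ = trans (encSubset-∅ (Registers.m M')) (cong zerosCode m≡mψ)

  noEqCode≡ : noEqCode ≡ replicateCode mψ (zerosCode mψ)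
  noEqCode≡ = trans (encSubsets-replicate {Registers.m M'} (Registers.m M') (∅ {Registers.m M'})) (cong₂ replicateCode m≡mψ ∅code≡)

  Xcode≡ : ∀ r → r ≤ 3 → Xcode r ≡ singletonCode r (Registers.m M' ∸ suc r)
  Xcode≡ r r≤3 =
    trans (encSubset-⁅⁆ (Registers.X M' r))
          (cong (λ z → singletonCode z (Registers.m M' ∸ suc z))
                (Registers.toX M' r (r<M (≤-trans r≤3 (≤-trans (n≤1+n _) (n≤1+n _))))))

  Xcode₀≡ : Xcode 0 ≡ singletonCode 0 (b0 + b0 + 7)
  Xcode₀≡ = trans (Xcode≡ 0 z≤n) (cong (singletonCode 0) (trans (cong (_∸ 1) m≡2b0+8) (+-∸-cancel (b0 + b0) 1 7)))
  Xcode₁≡ : Xcode 1 ≡ singletonCode 1 (b0 + b0 + 6)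
  Xcode₁≡ = trans (Xcode≡ 1 (s≤s z≤n)) (cong (singletonCode 1) (trans (cong (_∸ 2) m≡2b0+8) (+-∸-cancel (b0 + b0) 2 6)))
  Xcode₂≡ : Xcode 2 ≡ singletonCode 2 (b0 + b0 + 5)
  Xcode₂≡ = trans (Xcode≡ 2 (s≤s (s≤s z≤n))) (cong (singletonCode 2) (trans (cong (_∸ 3) m≡2b0+8) (+-∸-cancel (b0 + b0) 3 5)))
  Xcode₃≡ : Xcode 3 ≡ singletonCode 3 (b0 + b0 + 4)
  Xcode₃≡ = trans (Xcode≡ 3 (s≤s (s≤s (s≤s z≤n))))
                  (cong (singletonCode 3) (trans (cong (_∸ 4) m≡2b0+8) (+-∸-cancel (b0 + b0) 4 4)))

  transitionsCode≡ : transitionsCode (downFrom (suc top)) ≡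
    codeOfTransitions top a b0 c d s1 s2 s3 (zerosCode mψ) (replicateCode mψ (zerosCode mψ))
        (singletonCode 0 (b0 + b0 + 7)) (singletonCode 1 (b0 + b0 + 6)) (singletonCode 2 (b0 + b0 + 5))
        (singletonCode 3 (b0 + b0 + 4)) 1
  transitionsCode≡ =
    trans transitionsCode-P (cong6 (λ zm k2 e0 e1 e2 e3 → codeOfTransitions top a b0 c d s1 s2 s3 zm k2 e0 e1 e2 e3 1)
                                   ∅code≡ noEqCode≡ Xcode₀≡ Xcode₁≡ Xcode₂≡ Xcode₃≡)

  initialCode≡ : encSubset (⁅ clamp {top} a ⁆) ≡ singletonCode a L
  initialCode≡ =
    trans (encSubset-⁅⁆ (clamp {top} a))
          (trans (cong (λ z → singletonCode z (suc top ∸ suc z)) (toℕ-clamp {top} a (s≤s a≤top)))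
                 (cong (singletonCode a) (m+n∸m≡n a L)))

  finalCode≡ : encSubset (⁅ fz {top} ⁆) ≡ singletonCode 0 top
  finalCode≡ = encSubset-⁅⁆ (fz {top})

  code-A≡ψ : code A ≡ ψ a b0 c d
  code-A≡ψ =
    trans (code≡list₅ (suc top) (Registers.m M') (FullRSA.Δ P) ⁅ clamp {top} a ⁆ ⁅ fz ⁆)
          (trans (cong5 list₅Code refl m≡mψ transitionsCode≡ initialCode≡ finalCode≡) (sym (ψ≡list₅ a b0 c d)))

  N : ℕ
  N = ψ a b0 c d

  σ₀ : Env
  σ₀ _ = 0

  loader-run : Σ Env λ σ4 → Steps P a σ₀ top σ4 × (σ4 0 ≡ a) × (σ4 1 ≡ b0) × (σ4 2 ≡ c) × (σ4 3 ≡ d)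
              × (∀ j → 4 ≤ j → σ4 j ≡ 0)
  loader-run =
    let (σ1 , st1 , v₁ , m1) = incChain-Steps {P} {a} {0} {a} suffix₀ σ₀
        (σ2 , st2 , v₂ , m2) = incChain-Steps {P} {a + a} {1} {b0} suffix₁ σ1
        (σ3 , st3 , v₃ , m3) = incChain-Steps {P} {a + a + b0} {2} {c} suffix₂ σ2
        (σ4 , st4 , v4 , m4) = incChain-Steps {P} {a + a + b0 + c} {3} {d} {jmp 1 ∷ []} suffix₃ σ3
    in σ4 , subst (λ z → Steps P a σ₀ z σ4) (sym top≡) (st1 ▷ st2 ▷ st3 ▷ st4) ,
       trans (m4 0 (λ ())) (trans (m3 0 (λ ())) (trans (m2 0 (λ ())) v₁)) ,
       trans (m4 1 (λ ())) (trans (m3 1 (λ ())) (trans v₂ (cong (_+ b0) (m1 1 (λ ()))))) ,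
       trans (m4 2 (λ ())) (trans v₃ (cong (_+ c) (trans (m2 2 (λ ())) (m1 2 (λ ()))))) ,
       trans v4 (cong (_+ d) (trans (m3 3 (λ ())) (trans (m2 3 (λ ())) (m1 3 (λ ()))))) ,
       λ j le → trans (m4 j (ne 3 (s≤s (s≤s (s≤s (s≤s z≤n)))) le)) (trans (m3 j (ne 2 (s≤s (s≤s (s≤s z≤n))) le))
                      (trans (m2 j (ne 1 (s≤s (s≤s z≤n)) le)) (m1 j (ne 0 (s≤s z≤n) le))))
    where
    ne : ∀ r {j} → r < 4 → 4 ≤ j → j ≢ r
    ne r lt le e = <⇒≢ (<-≤-trans lt le) (sym e)

  length-main-decide : length (flatten main 1 ++ decide) ≡ mainSize + 3
  length-main-decide = trans (length-++ (flatten main 1)) (cong (_+ 3) (length-flatten main 1))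

  fetch-decide : ∀ j → j < 3 → fetch P (suc (mainSize + j)) ≡ fetch decide j
  fetch-decide j j<3 =
    trans (fetch-++ˡ (flatten main 1 ++ decide) loader (mainSize + j)
                     (subst (mainSize + j <_) (sym length-main-decide) (+-monoʳ-< mainSize j<3)))
          (trans (cong (λ z → fetch (flatten main 1 ++ decide) (z + j)) (sym (length-flatten main 1)))
                 (fetch-++ʳ (flatten main 1) decide j))

  fetch-test₁ : fetch P (1 + mainSize) ≡ decjz 5 (2 + mainSize) (3 + mainSize)
  fetch-test₁ = subst (λ z → fetch P (suc z) ≡ decjz 5 (2 + mainSize) (3 + mainSize)) (+-identityʳ mainSize)
                      (fetch-decide 0 (s≤s z≤n))
  fetch-test₂ : fetch P (2 + mainSize) ≡ decjz 5 (3 + mainSize) 0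
  fetch-test₂ = subst (λ z → fetch P (suc z) ≡ decjz 5 (3 + mainSize) 0) (+-comm mainSize 1) (fetch-decide 1 (s≤s (s≤s z≤n)))
  fetch-rej : fetch P (3 + mainSize) ≡ rej
  fetch-rej = subst (λ z → fetch P (suc z) ≡ rej) (+-comm mainSize 2) (fetch-decide 2 (s≤s (s≤s (s≤s z≤n))))

  main-loaded : LoadedAt P 1 (flatten main 1)
  main-loaded = loadedAt λ i i< →
    trans (fetch-++ˡ (flatten main 1 ++ decide) loader i
                     (<-≤-trans i< (subst (length (flatten main 1) ≤_) (sym (length-++ (flatten main 1))) (m≤m+n _ _))))
          (fetch-++ˡ (flatten main 1) decide i i<)

  run-main : ∀ {y} → Eval p (N ∷ []) y → Σ Env λ σ6 → Steps P a σ₀ (1 + mainSize) σ6 × (σ6 5 ≡ y)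
  run-main {y} ev =
    let (σ4 , st4 , e0 , e1 , e2 , e3 , z4) = loader-run
        z6 : ∀ j → 6 ≤ j → σ4 j ≡ 0
        z6 j le = z4 j (≤-trans (n≤1+n _) (≤-trans (n≤1+n _) le))
        (σ5 , d5 , v5 , s5) = compilePR-correct ψPR (ψPR-correct (a ∷ b0 ∷ c ∷ d ∷ [])) (0 ∷ 1 ∷ 2 ∷ 3 ∷ []) 4 6 σ4 z6
                 (s≤s z≤n ∷ s≤s (s≤s z≤n) ∷ s≤s (s≤s (s≤s z≤n)) ∷ s≤s (s≤s (s≤s (s≤s z≤n))) ∷ [])
                 (s≤s (s≤s (s≤s (s≤s (s≤s z≤n)))))
                 ((λ ()) ∷ (λ ()) ∷ (λ ()) ∷ (λ ()) ∷ [])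
                 (cong₂ _∷_ e0 (cong₂ _∷_ e1 (cong₂ _∷_ e2 (cong₂ _∷_ e3 refl))))
        σ54 : σ5 4 ≡ N
        σ54 = trans v5 (cong (_+ N) (z4 4 ≤-refl))
        (σ6 , d6 , v6 , s6) = compilePR-correct p ev (4 ∷ []) 5 6 σ5
                 (λ j le → trans (s5 j (λ e → <⇒≢ (<-≤-trans (s≤s (s≤s (s≤s (s≤s (s≤s z≤n))))) le) (sym e))) (z6 j le))
                 (s≤s (s≤s (s≤s (s≤s (s≤s z≤n)))) ∷ []) (s≤s (s≤s (s≤s (s≤s (s≤s (s≤s z≤n))))))
                 ((λ ()) ∷ []) (cong (_∷ []) σ54)
        σ65 : σ6 5 ≡ y
        σ65 = trans v6 (cong (_+ y) (trans (s5 5 (λ ())) (z4 5 (s≤s (s≤s (s≤s (s≤s z≤n)))))))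
    in σ6 , (st4 ▷ more (s-jmp fetch-top) (flatten-correct (⇓seq d5 d6) P 1 main-loaded)) , σ65

  output1⇒accept : Eval p (N ∷ []) 1 → ReachesAccept P a σ₀
  output1⇒accept ev =
    let (σ6 , st , e) = run-main ev
    in _ , (st ▷ more (s-decS fetch-test₁ e) (more (s-decZ fetch-test₂ (assign-≡ σ6 5 0)) done))

  output0⇒reject : Eval p (N ∷ []) 0 → Σ Env λ τ → Steps P a σ₀ (3 + mainSize) τ
  output0⇒reject ev =
    let (σ6 , st , e) = run-main ev
    in _ , (st ▷ more (s-decZ fetch-test₁ e) done)

  output1⇒nonempty : (𝔻 : Set) → ℕ ↣ 𝔻 → Eval p (code A ∷ []) 1 → ¬ IsEmpty 𝔻 A
  output1⇒nonempty 𝔻 inj ev =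
    FullRSA.Simulation.toRSA-complete 𝔻 inj P-wellFormed (s≤s a≤top)
      (output1⇒accept (subst (λ z → Eval p (z ∷ []) 1) code-A≡ψ ev))

  output0⇒empty : (𝔻 : Set) → Eval p (code A ∷ []) 0 → IsEmpty 𝔻 A
  output0⇒empty 𝔻 ev (w , accepted) =
    let (_ , accepting) = FullRSA.Simulation.toRSA-sound 𝔻 P-wellFormed (s≤s a≤top) accepted
        (τ , rejecting) = output0⇒reject (subst (λ z → Eval p (z ∷ []) 0) code-A≡ψ ev)
    in case Steps-halted-unique (cong (λ i → execute i τ) fetch-rej) refl rejecting accepting of λ ()

theorem7p2 : (k : ℕ) (𝔻 : Set) → (ℕ ↣ 𝔻) →
    ¬ (Σ (PR 1) λ p → (A : RSA k) →
    (IsEmpty 𝔻 A → Eval p (code A ∷ []) 1)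
    × (¬ IsEmpty 𝔻 A → Eval p (code A ∷ []) 0))
theorem7p2 k 𝔻 inj (p , decides) = nonempty (output0⇒empty 𝔻 (proj₂ (decides A) nonempty))
  where
  open Diagonal k p
  nonempty : ¬ IsEmpty 𝔻 A
  nonempty empty = output1⇒nonempty 𝔻 inj (proj₁ (decides A) empty) empty
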